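{- Let $n$ be a positive integer and consider the group $\mathbb{Z}/n\mathbb{Z}$ under addition. The saturated subsets of $\mathbb{Z}/n\mathbb{Z}$ are: (a) if $n=2k+1$: the sets $\{a,b\}$ with $a\neq b$; (b) if $n=4k+2$: the sets $\{a,a+x,a+2x\}$ with $x$ odd, $x\neq n/2$, and $a$ even; the sets $\{a,a+n/2\}$; and, if $k>0$, the set $\{x \mid x=2l+1,\ 1\le l\le n/2\}$ of all odd elements; (c) if $n=4k$: the sets $\{a,a+x,a+2x\}$ with $x$ odd and $a$ even; the sets $\{a,a+4x\}$ with $a$ even and $x\neq n/4$; and the set $\{x \mid x=2l+1,\ 1\le l\le n/2\}$ of all odd elements.
   Context: For a set $S$ with a binary operation, a subset $U\subseteq S$ is avoidable if there is a partition $\{A,B\}$ of $S$ such that no element of $U$ is the product of two distinct elements of $A$ or of two distinct elements of $B$. A subset is saturated if it is maximal with respect to inclusion among the avoidable subsets of $S$. In an abelian group (written additively), an element $b$ is called even if there exists $x$ with $2x=b$, and odd otherwise. -}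

module Defs where

open import Data.Nat as ℕ using (ℕ; NonZero; _%_; _≤_; _*_; _+_; _/_)
open import Data.Nat.DivMod using (m%n<n)
open import Data.Fin using (Fin; toℕ; fromℕ<)
open import Data.Fin.Subset using (Subset; _∈_; _⊆_; Nonempty; ∁)
open import Data.Product using (∃; ∃₂; _×_)
open import Data.Sum using (_⊎_)
open import Function.Bundles using (_⇔_)
open import Relation.Binary.PropositionalEquality using (_≡_; _≢_)
open import Relation.Nullary using (¬_)

module _ {n : ℕ} (_∙_ : Fin n → Fin n → Fin n) where

  IsProductIn : Subset n → Fin n → Set
  IsProductIn A u = ∃₂ λ x y → x ≢ y × x ∈ A × y ∈ A × (x ∙ y) ≡ u

  Avoidable : Subset n → Set
  Avoidable U = ∃ λ (A : Subset n) → Nonempty A × Nonempty (∁ A) ×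
    (∀ u → u ∈ U → (¬ IsProductIn A u) × (¬ IsProductIn (∁ A) u))

  Saturated : Subset n → Set
  Saturated U = Avoidable U × (∀ V → U ⊆ V → Avoidable V → V ⊆ U)

[_]ₙ : ∀ {n} {{_ : NonZero n}} → ℕ → Fin n
[_]ₙ {n} m = fromℕ< (m%n<n m n)

infixl 6 _⊕_
_⊕_ : ∀ {n} {{_ : NonZero n}} → Fin n → Fin n → Fin n
x ⊕ y = [ toℕ x + toℕ y ]ₙ

Even : ∀ {n} {{_ : NonZero n}} → Fin n → Set
Even {n} b = ∃ λ (x : Fin n) → x ⊕ x ≡ b

Odd : ∀ {n} {{_ : NonZero n}} → Fin n → Set
Odd b = ¬ Even b

infix 4 _≐_
_≐_ : ∀ {n} → Subset n → (Fin n → Set) → Set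
U ≐ P = ∀ z → (z ∈ U) ⇔ P z

Pair : ∀ {n} → Fin n → Fin n → Fin n → Set
Pair a b z = z ≡ a ⊎ z ≡ b

Triple : ∀ {n} {{_ : NonZero n}} → Fin n → Fin n → Fin n → Set
Triple a x z = z ≡ a ⊎ z ≡ a ⊕ x ⊎ z ≡ a ⊕ x ⊕ x

OddSet : ∀ {n} {{_ : NonZero n}} → Fin n → Set
OddSet {n} z = ∃ λ l → 1 ≤ l × l ≤ n / 2 × z ≡ [ 2 * l + 1 ]ₙ

{-# OPTIONS --safe #-}
-- A set U is avoidable exactly when some non-constant colouring χ of ℤ/n gives
-- different colours to any two distinct summands x + y = u of each u ∈ U.  If χ
-- does so for u, v, w and 2x + v = u + w, then the walk x ↦ u − x ↦ v − u + x ↦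
-- w − v + u − x = x has odd length and the colour alternates along it, which is
-- absurd; a five-step walk through u = a, b, c, a, c with 2y + b = 2c works the
-- same way.  For odd n every element is a double, so no colouring handles three
-- elements, and the saturated sets are the pairs; a pair {a, b} is handled by a
-- colouring built from gcd(b − a, n).  For even n the walks, run through the
-- parity classes, confine an avoidable set to the odd elements, to a triple
-- a, a + x, a + 2x with a even and x odd, or to two even elements.  Pairs and
-- such triples are handled by colourings of ℤ/n interleaved from colourings of
-- ℤ/(n/2) on the even and on the odd elements, and the odd elements by the
-- parity colouring.

module Submission where

open import Algebra.Bundles using (AbelianGroup)
open import Algebra.Core using (Op₁; Op₂)
open import Algebra.Structures using (IsAbelianGroup)
open import Data.Bool using (Bool; true; false; not)
open import Data.Bool.Properties using (not-¬; ¬-not; not-involutive; not-injective)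
open import Data.Empty using (⊥; ⊥-elim)
open import Data.Fin using (Fin; toℕ; _≟_)
open import Data.Fin.Properties using (toℕ-fromℕ<; toℕ-injective; toℕ<n; any?)
open import Data.Fin.Subset using (Subset; _∈_; ∁)
open import Data.Fin.Subset.Properties using (_∈?_; x∉p⇒x∈∁p; x∈∁p⇒x∉p)
open import Data.Nat
  using (ℕ; NonZero; zero; suc; pred; _+_; _*_; _∸_; _/_; _%_; _<_; _≤_; _>_; _<?_; _≤?_; z≤n; s≤s;
         ≢-nonZero; ≢-nonZero⁻¹; >-nonZero⁻¹)
  renaming (_≟_ to _≟ℕ_)
open import Data.Nat.Coprimality using (Coprime; coprime-/gcd; coprime⇒GCD≡1)
open import Data.Nat.DivMod
  using (%-distribˡ-+; %-distribˡ-*; [m+kn]%n≡m%n; m%n%n≡m%n; m<n⇒m%n≡m; n%n≡0; m%n<n; m%n≤m;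
         m≡m%n+[m/n]*n; m/n*n≡m; m<n*o⇒m/o<n; m%n*o≡m*o%[n*o]; %-congʳ; m∣n⇒o%n%m≡o%m; m*n%n≡0; m/n<m;
         m*n/n≡m)
open import Data.Nat.Divisibility
  using (_∣_; divides; _∣?_; ∣-trans; n∣m*n; ∣m+n∣m⇒∣n; n∣m⇒m%n≡0; m%n≡0⇒n∣m; ∣⇒≤)
open import Data.Nat.GCD using (gcd; gcd[m,n]∣m; gcd[m,n]∣n; gcd[m,n]≢0; module Bézout)
open import Data.Nat.Induction using (<-rec)
open import Data.Nat.Properties
  using (suc-pred; suc-injective; +-assoc; +-comm; +-suc; +-identityʳ; *-comm; *-assoc; *-identityˡ;
         *-identityʳ; *-distribʳ-+; *-distribˡ-+; *-cancelʳ-≡; m*n≢0; m∸n+n≡m; ≤-refl; ≤-reflexive; ≤-trans;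
         ≤-antisym; ≤-pred; <-irrefl; <-≤-trans; <⇒≤; <⇒≱; ≮⇒≥; ≰⇒>; n≤1+n; m≤m+n; m≤n+m; m<m+n; m≤m*n;
         m<m*n; n≤1⇒n≡0∨n≡1; n<1⇒n≡0; n≢0⇒n>0; m+n≡0⇒m≡0; +-mono-≤; +-monoʳ-≤; +-mono-<; +-monoˡ-<;
         +-cancelʳ-≤; +-cancelʳ-<; *-monoˡ-≤; *-monoˡ-<; *-monoʳ-≤; *-monoʳ-<)
open import Data.Nat.Tactic.RingSolver using (solve-∀)
open import Data.Product using (∃; ∃₂; _×_; _,_; proj₁; proj₂)
open import Data.Sum using (_⊎_; inj₁; inj₂; [_,_]′; map)
open import Data.Vec using (tabulate)
open import Data.Vec.Properties using ([]=⇒lookup; lookup⇒[]=; lookup∘tabulate)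
open import Function using (_∘_; id; flip)
open import Function.Bundles using (_⇔_; mk⇔; Equivalence)
open import Level using (0ℓ)
open import Relation.Binary.Bundles using (Setoid)
open import Relation.Binary.PropositionalEquality
import Relation.Binary.Reasoning.Setoid
open import Relation.Nullary using (¬_; Dec; yes; no; does)
import Relation.Nullary.Decidable
open import Relation.Nullary.Decidable using (⌊_⌋; _×-dec_; _⊎-dec_; ¬?; decidable-stable)
open import Relation.Unary using (Decidable)

open import Defs

-- Colourings and avoidable sets

module _ {A : Set} (_∙_ : Op₂ A) where

  Avoids : (A → Bool) → A → Set
  Avoids χ u = ∀ x y → x ≢ y → x ∙ y ≡ u → χ x ≢ χ y

  avoids-not : ∀ {χ u} → Avoids χ u → Avoids (not ∘ χ) u
  avoids-not avoids x y x≢y sum = avoids x y x≢y sum ∘ not-injective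

module _ {n : ℕ} (_∙_ : Fin n → Fin n → Fin n) where

  private
    variable
      χ : Fin n → Bool
      U : Subset n
      P : Fin n → Set

  NonConstant : (Fin n → Bool) → Set
  NonConstant χ = ∃₂ λ x y → χ x ≡ true × χ y ≡ false

  nonConstant : ∀ x y → χ x ≢ χ y → NonConstant χ
  nonConstant {χ} x y χx≢χy with χ x in χx | χ y in χy
  ... | true  | true  = ⊥-elim (χx≢χy refl)
  ... | true  | false = x , y , χx , χy
  ... | false | true  = y , x , χy , χx
  ... | false | false = ⊥-elim (χx≢χy refl)

  avoidable⇒colouring : Avoidable _∙_ U → ∃ λ χ → NonConstant χ × ∀ u → u ∈ U → Avoids _∙_ χ u
  avoidable⇒colouring {U} (A , (x , x∈A) , (y , y∈∁A) , avoids) =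
    inA , nonConstant x y x≢y-in-A , avoidsU
    where
    inA : Fin n → Bool
    inA z = does (z ∈? A)
    x≢y-in-A : inA x ≢ inA y
    x≢y-in-A with x ∈? A | y ∈? A
    ... | yes _   | no _    = λ ()
    ... | no x∉A  | _       = ⊥-elim (x∉A x∈A)
    ... | yes _   | yes y∈A = ⊥-elim (x∈∁p⇒x∉p y∈∁A y∈A)
    avoidsU : ∀ u → u ∈ U → Avoids _∙_ inA u
    avoidsU u u∈U a b a≢b sum with a ∈? A | b ∈? A
    ... | yes a∈A | yes b∈A = λ _ → proj₁ (avoids u u∈U) (a , b , a≢b , a∈A , b∈A , sum)
    ... | no a∉A  | no b∉A  =
      λ _ → proj₂ (avoids u u∈U) (a , b , a≢b , x∉p⇒x∈∁p a∉A , x∉p⇒x∈∁p b∉A , sum)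
    ... | yes _   | no _    = λ ()
    ... | no _    | yes _   = λ ()

  colouring⇒avoidable : NonConstant χ → (∀ u → u ∈ U → Avoids _∙_ χ u) → Avoidable _∙_ U
  colouring⇒avoidable {χ} (x , y , χx , χy) avoidsU =
    A , (x , true⇒∈ χx) , (y , x∉p⇒x∈∁p (λ y∈A → true≢false (trans (sym (∈⇒true y∈A)) χy))) ,
    λ u u∈U → (λ (a , b , a≢b , a∈A , b∈A , sum) →
                 avoidsU u u∈U a b a≢b sum (trans (∈⇒true a∈A) (sym (∈⇒true b∈A))))
            , (λ (a , b , a≢b , a∈∁A , b∈∁A , sum) →
                 avoidsU u u∈U a b a≢b sum (trans (∈∁⇒false a∈∁A) (sym (∈∁⇒false b∈∁A))))
    where
    A : Subset n
    A = tabulate χ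
    true≢false : true ≢ false
    true≢false ()
    ∈⇒true : ∀ {z} → z ∈ A → χ z ≡ true
    ∈⇒true {z} z∈A = trans (sym (lookup∘tabulate χ z)) ([]=⇒lookup z∈A)
    true⇒∈ : ∀ {z} → χ z ≡ true → z ∈ A
    true⇒∈ {z} χz = lookup⇒[]= z A (trans (lookup∘tabulate χ z) χz)
    ∈∁⇒false : ∀ {z} → z ∈ ∁ A → χ z ≡ false
    ∈∁⇒false z∈∁A = ¬-not (λ χz → x∈∁p⇒x∉p z∈∁A (true⇒∈ χz))

  AvoidableByColouring : (Fin n → Set) → Set
  AvoidableByColouring P = ∃ λ χ → NonConstant χ × ∀ z → P z → Avoids _∙_ χ z

  Maximal : (Fin n → Set) → Set
  Maximal P = ∀ χ → (∀ z → P z → Avoids _∙_ χ z) → ∀ z → Avoids _∙_ χ z → P z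

  saturated-if-≐ : U ≐ P → AvoidableByColouring P → Maximal P → Saturated _∙_ U
  saturated-if-≐ {U} {P} U≐P (χ , nonConst , avoidsP) maximal =
    colouring⇒avoidable nonConst (λ u → avoidsP u ∘ Equivalence.to (U≐P u)) ,
    λ V U⊆V avoidableV {z} z∈V →
      let (ψ , _ , avoidsV) = avoidable⇒colouring avoidableV in
      Equivalence.from (U≐P z)
        (maximal ψ (λ w → avoidsV w ∘ U⊆V ∘ Equivalence.from (U≐P w)) z (avoidsV z z∈V))

  ≐-if-saturated : Saturated _∙_ U → Decidable P → AvoidableByColouring P →
                   (∀ z → z ∈ U → P z) → U ≐ P
  ≐-if-saturated {U} {P} (_ , maximal) P? (χ , nonConst , avoidsP) U⊆P z =
    mk⇔ (U⊆P z) (λ Pz → maximal V (λ {w} w∈U → ∈V (U⊆P w w∈U)) avoidableV (∈V Pz))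
    where
    V : Subset n
    V = tabulate (does ∘ P?)
    ∈V : ∀ {w} → P w → w ∈ V
    ∈V {w} Pw with P? w in eq
    ... | yes _ = lookup⇒[]= w V (trans (lookup∘tabulate (does ∘ P?) w) (cong does eq))
    ... | no ¬Pw = ⊥-elim (¬Pw Pw)
    V⇒P : ∀ {w} → w ∈ V → P w
    V⇒P {w} w∈V with P? w | trans (sym (lookup∘tabulate (does ∘ P?) w)) ([]=⇒lookup w∈V)
    ... | yes Pw | _ = Pw
    avoidableV : Avoidable _∙_ V
    avoidableV = colouring⇒avoidable nonConst (λ w → avoidsP w ∘ V⇒P)

data Witnesses {n : ℕ} (Q : Fin n → Set) : Set where
  none   : (∀ z → ¬ Q z) → Witnesses Q
  unique : ∀ a → Q a → (∀ z → Q z → z ≡ a) → Witnesses Q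
  two    : ∀ a b → Q a → Q b → a ≢ b → Witnesses Q

witnesses : ∀ {n} {Q : Fin n → Set} → Decidable Q → Witnesses Q
witnesses {Q = Q} Q? with any? Q?
... | no ∄ = none (λ z Qz → ∄ (z , Qz))
... | yes (a , Qa) with any? (λ z → Q? z ×-dec ¬? (z ≟ a))
...   | yes (b , Qb , b≢a) = two a b Qa Qb (b≢a ∘ sym)
...   | no ∄ = unique a Qa (λ z Qz → decidable-stable (z ≟ a) (λ z≢a → ∄ (z , Qz , z≢a)))

pair? : ∀ {n} (a b z : Fin n) → Dec (Pair a b z)
pair? a b z = (z ≟ a) ⊎-dec (z ≟ b)

triple? : ∀ {n} {{_ : NonZero n}} (a x z : Fin n) → Dec (Triple a x z)
triple? a x z = (z ≟ a) ⊎-dec (z ≟ a ⊕ x) ⊎-dec (z ≟ a ⊕ x ⊕ x)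

-- Odd closed walks in abelian groups

module AbelianGroupColourings {A : Set} {op : Op₂ A} {e : A} {inv : Op₁ A}
  (isAbelianGroup : IsAbelianGroup _≡_ op e inv) where

  abelianGroup : AbelianGroup 0ℓ 0ℓ
  abelianGroup = record { isAbelianGroup = isAbelianGroup }

  open AbelianGroup abelianGroup using (_∙_; ε; _⁻¹; comm; identityˡ; identityʳ; commutativeMonoid)
  open import Algebra.Properties.AbelianGroup abelianGroup
    using (//-rightDividesˡ; //-rightDividesʳ; ∙-cancelˡ; ∙-cancelʳ; ⁻¹-injective; ⁻¹-∙-comm)
  open import Algebra.Solver.CommutativeMonoid commutativeMonoid using (solve; _⊜_)
    renaming (_⊕_ to _⊞_)
  open ≡-Reasoning

  infixl 6 _-_
  _-_ : Op₂ A
  u - x = u ∙ x ⁻¹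

  private
    variable
      χ : A → Bool
      a b c u v w x y : A

  [x-y]∙y≡x : ∀ x y → (x - y) ∙ y ≡ x
  [x-y]∙y≡x x y = //-rightDividesˡ y x

  x∙y≡z⇒z-y≡x : a ∙ b ≡ c → c - b ≡ a
  x∙y≡z⇒z-y≡x {a} {b} refl = //-rightDividesʳ b a

  x∙[y-x]≡y : ∀ x y → x ∙ (y - x) ≡ y
  x∙[y-x]≡y x y = trans (comm x (y - x)) ([x-y]∙y≡x y x)

  [x-y]∙z≡[x∙z]-y : ∀ x y z → (x - y) ∙ z ≡ (x ∙ z) - y
  [x-y]∙z≡[x∙z]-y x y z = solve 3 (λ p q r → (p ⊞ q) ⊞ r ⊜ (p ⊞ r) ⊞ q) refl x (y ⁻¹) z

  x≢x∙y : ∀ x {y} → y ≢ ε → x ≢ x ∙ y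
  x≢x∙y x {y} y≢ε x≡x∙y = y≢ε (sym (∙-cancelˡ x ε y (trans (identityʳ x) x≡x∙y)))

  ∙-double : ∀ x y → (x ∙ y) ∙ (x ∙ y) ≡ (x ∙ x) ∙ (y ∙ y)
  ∙-double = solve 2 (λ p q → (p ⊞ q) ⊞ (p ⊞ q) ⊜ (p ⊞ p) ⊞ (q ⊞ q)) refl

  x∙x≡y∙y⇒[x-y]∙[x-y]≡ε : a ∙ a ≡ b ∙ b → (a - b) ∙ (a - b) ≡ ε
  x∙x≡y∙y⇒[x-y]∙[x-y]≡ε {a} {b} aa≡bb = ∙-cancelʳ (b ∙ b) _ _ (begin
      ((a - b) ∙ (a - b)) ∙ (b ∙ b)    ≡⟨ ∙-double (a - b) b ⟨
      ((a - b) ∙ b) ∙ ((a - b) ∙ b)    ≡⟨ cong (λ z → z ∙ z) ([x-y]∙y≡x a b) ⟩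
      a ∙ a                            ≡⟨ aa≡bb ⟩
      b ∙ b                            ≡⟨ identityˡ (b ∙ b) ⟨
      ε ∙ (b ∙ b)                      ∎)

  alternates : Avoids _∙_ χ u → y ∙ x ≡ u → y ≢ x → χ y ≡ not (χ x)
  alternates avoids sum y≢x = ¬-not (avoids _ _ y≢x sum)

  -- The walk x ↦ u − x ↦ v − u + x ↦ w − v + u − x returns to x; each step
  -- flips the colour, which is impossible for a cycle of odd length.
  triangle : Avoids _∙_ χ u → Avoids _∙_ χ v → Avoids _∙_ χ w →
             u ≢ v → v ≢ w → u ≢ w → (∃ λ x → x ∙ x ∙ v ≡ u ∙ w) → ⊥
  triangle {χ} {u} {v} {w} χu χv χw u≢v v≢w u≢w (x , mid) = not-¬ refl (begin
      χ x                ≡⟨ cong χ (sym closes) ⟩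
      χ x₃               ≡⟨ alternates χw e₃ x₃≢x₂ ⟩
      not (χ x₂)         ≡⟨ cong not (alternates χv e₂ x₂≢x₁) ⟩
      not (not (χ x₁))   ≡⟨ not-involutive _ ⟩
      χ x₁               ≡⟨ alternates χu e₁ x₁≢x ⟩
      not (χ x)          ∎)
    where
    x₁ = u - x
    x₂ = v - x₁
    x₃ = w - x₂
    e₁ : x₁ ∙ x ≡ u
    e₁ = [x-y]∙y≡x u x
    e₂ : x₂ ∙ x₁ ≡ v
    e₂ = [x-y]∙y≡x v x₁
    e₃ : x₃ ∙ x₂ ≡ w
    e₃ = [x-y]∙y≡x w x₂
    closes : x₃ ≡ x
    closes = ∙-cancelʳ (x₂ ∙ (x₁ ∙ x)) x₃ x (begin
      x₃ ∙ (x₂ ∙ (x₁ ∙ x))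
        ≡⟨ solve 4 (λ p q r s → p ⊞ (q ⊞ (r ⊞ s)) ⊜ (p ⊞ q) ⊞ (r ⊞ s)) refl x₃ x₂ x₁ x ⟩
      (x₃ ∙ x₂) ∙ (x₁ ∙ x)   ≡⟨ cong₂ _∙_ e₃ e₁ ⟩
      w ∙ u                  ≡⟨ comm w u ⟩
      u ∙ w                  ≡⟨ mid ⟨
      x ∙ x ∙ v              ≡⟨ cong (x ∙ x ∙_) e₂ ⟨
      x ∙ x ∙ (x₂ ∙ x₁)
        ≡⟨ solve 3 (λ p q r → (p ⊞ p) ⊞ (q ⊞ r) ⊜ p ⊞ (q ⊞ (r ⊞ p))) refl x x₂ x₁ ⟩
      x ∙ (x₂ ∙ (x₁ ∙ x))    ∎)
    x₁≢x : x₁ ≢ x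
    x₁≢x x₁≡x = v≢w (∙-cancelˡ u v w (begin
      u ∙ v       ≡⟨ cong (_∙ v) (subst (λ z → z ∙ x ≡ u) x₁≡x e₁) ⟨
      x ∙ x ∙ v   ≡⟨ mid ⟩
      u ∙ w       ∎))
    x₂≢x₁ : x₂ ≢ x₁
    x₂≢x₁ x₂≡x₁ = u≢w (∙-cancelˡ u u w (begin
      u ∙ u                  ≡⟨ cong₂ _∙_ e₁ e₁ ⟨
      (x₁ ∙ x) ∙ (x₁ ∙ x)    ≡⟨ trans (∙-double x₁ x) (comm _ _) ⟩
      x ∙ x ∙ (x₁ ∙ x₁)      ≡⟨ cong (x ∙ x ∙_) (subst (λ z → z ∙ x₁ ≡ v) x₂≡x₁ e₂) ⟩
      x ∙ x ∙ v              ≡⟨ mid ⟩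
      u ∙ w                  ∎))
    x₃≢x₂ : x₃ ≢ x₂
    x₃≢x₂ x₃≡x₂ = u≢v (sym (∙-cancelʳ (u ∙ w) v u (begin
      v ∙ (u ∙ w)                          ≡⟨ cong (v ∙_) mid ⟨
      v ∙ (x ∙ x ∙ v)                      ≡⟨ cong (λ z → z ∙ (x ∙ x ∙ z)) e₂ ⟨
      (x₂ ∙ x₁) ∙ (x ∙ x ∙ (x₂ ∙ x₁))
        ≡⟨ solve 3 (λ p q r → (p ⊞ q) ⊞ ((r ⊞ r) ⊞ (p ⊞ q))
                              ⊜ (p ⊞ p) ⊞ ((q ⊞ r) ⊞ (q ⊞ r))) refl x₂ x₁ x ⟩
      (x₂ ∙ x₂) ∙ ((x₁ ∙ x) ∙ (x₁ ∙ x))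
        ≡⟨ cong₂ _∙_ (subst (λ z → z ∙ x₂ ≡ w) x₃≡x₂ e₃) (cong₂ _∙_ e₁ e₁) ⟩
      w ∙ (u ∙ u)                          ≡⟨ solve 2 (λ p q → q ⊞ (p ⊞ p) ⊜ p ⊞ (p ⊞ q)) refl u w ⟩
      u ∙ (u ∙ w)                          ∎)))

  -- The same argument for the walk through the reflections in a, b, c, a, c.
  pentagon : Avoids _∙_ χ a → Avoids _∙_ χ b → Avoids _∙_ χ c → a ≢ b → b ≢ c →
             a ∙ b ≢ c ∙ c → a ∙ a ≢ c ∙ c → b ∙ c ≢ a ∙ a → (∃ λ y → y ∙ y ∙ b ≡ c ∙ c) → ⊥
  pentagon {χ} {a} {b} {c} χa χb χc a≢b b≢c ab≢cc aa≢cc bc≢aa (y , mid) = not-¬ refl (begin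
      χ y                ≡⟨ cong χ (sym closes) ⟩
      χ x₅               ≡⟨ alternates χc e₅ x₅≢x₄ ⟩
      not (χ x₄)         ≡⟨ cong not (alternates χa e₄ x₄≢x₃) ⟩
      not (not (χ x₃))   ≡⟨ not-involutive _ ⟩
      χ x₃               ≡⟨ alternates χc e₃ x₃≢x₂ ⟩
      not (χ x₂)         ≡⟨ cong not (alternates χb e₂ x₂≢x₁) ⟩
      not (not (χ x₁))   ≡⟨ not-involutive _ ⟩
      χ x₁               ≡⟨ alternates χa e₁ x₁≢y ⟩
      not (χ y)          ∎)
    where
    x₁ = a - y
    x₂ = b - x₁
    x₃ = c - x₂
    x₄ = a - x₃
    x₅ = c - x₄
    e₁ : x₁ ∙ y ≡ a
    e₁ = [x-y]∙y≡x a y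
    e₂ : x₂ ∙ x₁ ≡ b
    e₂ = [x-y]∙y≡x b x₁
    e₃ : x₃ ∙ x₂ ≡ c
    e₃ = [x-y]∙y≡x c x₂
    e₄ : x₄ ∙ x₃ ≡ a
    e₄ = [x-y]∙y≡x a x₃
    e₅ : x₅ ∙ x₄ ≡ c
    e₅ = [x-y]∙y≡x c x₄
    L = ((x₄ ∙ x₃) ∙ (x₂ ∙ x₁)) ∙ (y ∙ b)
    closes : x₅ ≡ y
    closes = ∙-cancelʳ L x₅ y (begin
      x₅ ∙ L
        ≡⟨ solve 7 (λ p q r s t u v → p ⊞ (((q ⊞ r) ⊞ (s ⊞ t)) ⊞ (u ⊞ v))
                                      ⊜ ((p ⊞ q) ⊞ (r ⊞ s)) ⊞ ((t ⊞ u) ⊞ v)) refl x₅ x₄ x₃ x₂ x₁ y b ⟩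
      ((x₅ ∙ x₄) ∙ (x₃ ∙ x₂)) ∙ ((x₁ ∙ y) ∙ b)
        ≡⟨ cong₂ (λ p q → (p ∙ q) ∙ ((x₁ ∙ y) ∙ b)) e₅ e₃ ⟩
      (c ∙ c) ∙ ((x₁ ∙ y) ∙ b)
        ≡⟨ cong (λ p → (c ∙ c) ∙ (p ∙ b)) e₁ ⟩
      (c ∙ c) ∙ (a ∙ b)
        ≡⟨ comm (c ∙ c) (a ∙ b) ⟩
      (a ∙ b) ∙ (c ∙ c)
        ≡⟨ cong₂ (λ p q → (p ∙ q) ∙ (c ∙ c)) e₄ e₂ ⟨
      ((x₄ ∙ x₃) ∙ (x₂ ∙ x₁)) ∙ (c ∙ c)
        ≡⟨ cong (((x₄ ∙ x₃) ∙ (x₂ ∙ x₁)) ∙_) mid ⟨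
      ((x₄ ∙ x₃) ∙ (x₂ ∙ x₁)) ∙ (y ∙ y ∙ b)
        ≡⟨ solve 6 (λ q r s t u v → ((q ⊞ r) ⊞ (s ⊞ t)) ⊞ ((u ⊞ u) ⊞ v)
                                    ⊜ u ⊞ (((q ⊞ r) ⊞ (s ⊞ t)) ⊞ (u ⊞ v))) refl x₄ x₃ x₂ x₁ y b ⟩
      y ∙ L ∎)
    x₁≢y : x₁ ≢ y
    x₁≢y x₁≡y = ab≢cc (begin
      a ∙ b       ≡⟨ cong (_∙ b) (subst (λ z → z ∙ y ≡ a) x₁≡y e₁) ⟨
      y ∙ y ∙ b   ≡⟨ mid ⟩
      c ∙ c       ∎)
    x₂≢x₁ : x₂ ≢ x₁
    x₂≢x₁ x₂≡x₁ = aa≢cc (∙-cancelʳ b (a ∙ a) (c ∙ c) (begin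
      (a ∙ a) ∙ b                  ≡⟨ cong (λ z → (z ∙ z) ∙ b) e₁ ⟨
      ((x₁ ∙ y) ∙ (x₁ ∙ y)) ∙ b
        ≡⟨ solve 3 (λ p q r → ((p ⊞ q) ⊞ (p ⊞ q)) ⊞ r ⊜ ((q ⊞ q) ⊞ r) ⊞ (p ⊞ p)) refl x₁ y b ⟩
      (y ∙ y ∙ b) ∙ (x₁ ∙ x₁)      ≡⟨ cong₂ _∙_ mid (subst (λ z → z ∙ x₁ ≡ b) x₂≡x₁ e₂) ⟩
      (c ∙ c) ∙ b                  ∎))
    x₃≢x₂ : x₃ ≢ x₂
    x₃≢x₂ x₃≡x₂ = bc≢aa (∙-cancelʳ (b ∙ c) (b ∙ c) (a ∙ a) (begin
      (b ∙ c) ∙ (b ∙ c)                          ≡⟨ ∙-double b c ⟩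
      (b ∙ b) ∙ (c ∙ c)                          ≡⟨ cong₂ (λ p q → (p ∙ p) ∙ q) e₂ mid ⟨
      ((x₂ ∙ x₁) ∙ (x₂ ∙ x₁)) ∙ (y ∙ y ∙ b)
        ≡⟨ solve 4 (λ p q r s → ((p ⊞ q) ⊞ (p ⊞ q)) ⊞ ((r ⊞ r) ⊞ s)
                                ⊜ ((p ⊞ p) ⊞ ((q ⊞ r) ⊞ (q ⊞ r))) ⊞ s) refl x₂ x₁ y b ⟩
      ((x₂ ∙ x₂) ∙ ((x₁ ∙ y) ∙ (x₁ ∙ y))) ∙ b
        ≡⟨ cong₂ (λ p q → (p ∙ (q ∙ q)) ∙ b) (subst (λ z → z ∙ x₂ ≡ c) x₃≡x₂ e₃) e₁ ⟩
      (c ∙ (a ∙ a)) ∙ b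
        ≡⟨ solve 3 (λ p q r → (r ⊞ (p ⊞ p)) ⊞ q ⊜ (p ⊞ p) ⊞ (q ⊞ r)) refl a b c ⟩
      (a ∙ a) ∙ (b ∙ c)                          ∎))
    x₄≢x₃ : x₄ ≢ x₃
    x₄≢x₃ x₄≡x₃ = a≢b (sym (∙-cancelʳ K b a (begin
      b ∙ K
        ≡⟨ solve 3 (λ p q r → q ⊞ ((r ⊞ r) ⊞ (p ⊞ q)) ⊜ (p ⊞ (q ⊞ q)) ⊞ (r ⊞ r)) refl a b c ⟩
      (a ∙ (b ∙ b)) ∙ (c ∙ c)
        ≡⟨ cong₂ (λ p q → (p ∙ (q ∙ q)) ∙ (c ∙ c)) (subst (λ z → z ∙ x₃ ≡ a) x₄≡x₃ e₄) e₂ ⟨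
      ((x₃ ∙ x₃) ∙ ((x₂ ∙ x₁) ∙ (x₂ ∙ x₁))) ∙ (c ∙ c)
        ≡⟨ cong (((x₃ ∙ x₃) ∙ ((x₂ ∙ x₁) ∙ (x₂ ∙ x₁))) ∙_) mid ⟨
      ((x₃ ∙ x₃) ∙ ((x₂ ∙ x₁) ∙ (x₂ ∙ x₁))) ∙ (y ∙ y ∙ b)
        ≡⟨ solve 5 (λ p q r s t → ((p ⊞ p) ⊞ ((q ⊞ r) ⊞ (q ⊞ r))) ⊞ ((s ⊞ s) ⊞ t)
                                  ⊜ (((p ⊞ q) ⊞ (p ⊞ q)) ⊞ ((r ⊞ s) ⊞ (r ⊞ s))) ⊞ t) refl x₃ x₂ x₁ y b ⟩
      (((x₃ ∙ x₂) ∙ (x₃ ∙ x₂)) ∙ ((x₁ ∙ y) ∙ (x₁ ∙ y))) ∙ b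
        ≡⟨ cong₂ (λ p q → ((p ∙ p) ∙ (q ∙ q)) ∙ b) e₃ e₁ ⟩
      ((c ∙ c) ∙ (a ∙ a)) ∙ b
        ≡⟨ solve 3 (λ p q r → ((r ⊞ r) ⊞ (p ⊞ p)) ⊞ q ⊜ p ⊞ ((r ⊞ r) ⊞ (p ⊞ q))) refl a b c ⟩
      a ∙ K ∎)))
      where K = (c ∙ c) ∙ (a ∙ b)
    x₅≢x₄ : x₅ ≢ x₄
    x₅≢x₄ x₅≡x₄ = b≢c (∙-cancelʳ K b c (begin
      b ∙ K
        ≡⟨ solve 3 (λ p q r → q ⊞ (((p ⊞ p) ⊞ (r ⊞ r)) ⊞ q)
                              ⊜ ((p ⊞ p) ⊞ (q ⊞ q)) ⊞ (r ⊞ r)) refl a b c ⟩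
      ((a ∙ a) ∙ (b ∙ b)) ∙ (c ∙ c)
        ≡⟨ cong₂ (λ p q → ((p ∙ p) ∙ (q ∙ q)) ∙ (c ∙ c)) e₄ e₂ ⟨
      (((x₄ ∙ x₃) ∙ (x₄ ∙ x₃)) ∙ ((x₂ ∙ x₁) ∙ (x₂ ∙ x₁))) ∙ (c ∙ c)
        ≡⟨ cong ((((x₄ ∙ x₃) ∙ (x₄ ∙ x₃)) ∙ ((x₂ ∙ x₁) ∙ (x₂ ∙ x₁))) ∙_) mid ⟨
      (((x₄ ∙ x₃) ∙ (x₄ ∙ x₃)) ∙ ((x₂ ∙ x₁) ∙ (x₂ ∙ x₁))) ∙ (y ∙ y ∙ b)
        ≡⟨ solve 6 (λ p q r s t u → (((p ⊞ q) ⊞ (p ⊞ q)) ⊞ ((r ⊞ s) ⊞ (r ⊞ s))) ⊞ ((t ⊞ t) ⊞ u)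
                                    ⊜ (((p ⊞ p) ⊞ ((q ⊞ r) ⊞ (q ⊞ r))) ⊞ ((s ⊞ t) ⊞ (s ⊞ t))) ⊞ u)
                   refl x₄ x₃ x₂ x₁ y b ⟩
      (((x₄ ∙ x₄) ∙ ((x₃ ∙ x₂) ∙ (x₃ ∙ x₂))) ∙ ((x₁ ∙ y) ∙ (x₁ ∙ y))) ∙ b
        ≡⟨ cong₂ (λ p q → ((p ∙ (q ∙ q)) ∙ ((x₁ ∙ y) ∙ (x₁ ∙ y))) ∙ b)
                 (subst (λ z → z ∙ x₄ ≡ c) x₅≡x₄ e₅) e₃ ⟩
      ((c ∙ (c ∙ c)) ∙ ((x₁ ∙ y) ∙ (x₁ ∙ y))) ∙ b
        ≡⟨ cong (λ q → ((c ∙ (c ∙ c)) ∙ (q ∙ q)) ∙ b) e₁ ⟩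
      ((c ∙ (c ∙ c)) ∙ (a ∙ a)) ∙ b
        ≡⟨ solve 3 (λ p q r → ((r ⊞ (r ⊞ r)) ⊞ (p ⊞ p)) ⊞ q
                              ⊜ r ⊞ (((p ⊞ p) ⊞ (r ⊞ r)) ⊞ q)) refl a b c ⟩
      c ∙ K ∎))
      where K = ((a ∙ a) ∙ (c ∙ c)) ∙ b

  avoids⇒χε≢χ : Avoids _∙_ χ u → u ≢ ε → χ ε ≢ χ u
  avoids⇒χε≢χ avoids u≢ε = avoids ε _ (u≢ε ∘ sym) (identityˡ _)

  avoids-translate : Avoids _∙_ χ w → Avoids _∙_ (λ z → χ (z - c)) (w ∙ (c ∙ c))
  avoids-translate {χ} {w} {c} avoids x y x≢y sum =
    avoids (x - c) (y - c) (x≢y ∘ ∙-cancelʳ (c ⁻¹) x y) (∙-cancelʳ (c ∙ c) _ _ (begin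
      ((x - c) ∙ (y - c)) ∙ (c ∙ c)
        ≡⟨ solve 3 (λ p q r → (p ⊞ q) ⊞ (r ⊞ r) ⊜ (p ⊞ r) ⊞ (q ⊞ r)) refl (x - c) (y - c) c ⟩
      ((x - c) ∙ c) ∙ ((y - c) ∙ c)    ≡⟨ cong₂ _∙_ ([x-y]∙y≡x x c) ([x-y]∙y≡x y c) ⟩
      x ∙ y                            ≡⟨ sum ⟩
      w ∙ (c ∙ c)                      ∎))

  avoids-reflect : Avoids _∙_ χ w → u ∙ w ≡ c ∙ c → Avoids _∙_ (λ z → χ (c - z)) u
  avoids-reflect {χ} {w} {u} {c} avoids uw≡cc x y x≢y sum =
    avoids (c - x) (c - y) (x≢y ∘ ⁻¹-injective ∘ ∙-cancelˡ c _ _) (∙-cancelʳ u _ _ (begin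
      ((c - x) ∙ (c - y)) ∙ u          ≡⟨ cong (((c - x) ∙ (c - y)) ∙_) sum ⟨
      ((c - x) ∙ (c - y)) ∙ (x ∙ y)
        ≡⟨ solve 4 (λ p q r s → (p ⊞ q) ⊞ (r ⊞ s) ⊜ (p ⊞ r) ⊞ (q ⊞ s)) refl (c - x) (c - y) x y ⟩
      ((c - x) ∙ x) ∙ ((c - y) ∙ y)    ≡⟨ cong₂ _∙_ ([x-y]∙y≡x c x) ([x-y]∙y≡x c y) ⟩
      c ∙ c                            ≡⟨ uw≡cc ⟨
      u ∙ w                            ≡⟨ comm u w ⟩
      w ∙ u                            ∎))

  Double : A → Set
  Double b = ∃ λ x → x ∙ x ≡ b

  double-∙ : Double a → Double b → Double (a ∙ b)
  double-∙ (x , refl) (y , refl) = x ∙ y , ∙-double x y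

  double-⁻¹ : Double a → Double (a ⁻¹)
  double-⁻¹ (x , refl) = x ⁻¹ , ⁻¹-∙-comm x x

  double⇒midpoint : ∀ u w v → Double (u ∙ w - v) → ∃ λ x → x ∙ x ∙ v ≡ u ∙ w
  double⇒midpoint u w v (x , xx≡) = x , trans (cong (_∙ v) xx≡) ([x-y]∙y≡x (u ∙ w) v)

-- Arithmetic modulo N and the group ℤ/N

module Congruence (N : ℕ) {{_ : NonZero N}} where

  infix 4 _≋_
  record _≋_ (a b : ℕ) : Set where
    constructor mk≋
    field %-≡ : a % N ≡ b % N
  open _≋_ public

  ≋-refl : ∀ {a} → a ≋ a
  ≋-refl = mk≋ refl

  ≋-sym : ∀ {a b} → a ≋ b → b ≋ a
  ≋-sym (mk≋ p) = mk≋ (sym p)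

  ≋-trans : ∀ {a b c} → a ≋ b → b ≋ c → a ≋ c
  ≋-trans (mk≋ p) (mk≋ q) = mk≋ (trans p q)

  ≋-reflexive : ∀ {a b} → a ≡ b → a ≋ b
  ≋-reflexive refl = ≋-refl

  ≋-setoid : Setoid 0ℓ 0ℓ
  ≋-setoid = record
    { Carrier = ℕ
    ; _≈_ = _≋_
    ; isEquivalence = record { refl = ≋-refl ; sym = ≋-sym ; trans = ≋-trans }
    }

  module ≋-Reasoning = Relation.Binary.Reasoning.Setoid ≋-setoid

  +-cong : ∀ {a b c d} → a ≋ b → c ≋ d → a + c ≋ b + d
  +-cong {a} {b} {c} {d} (mk≋ p) (mk≋ q) = mk≋ (begin
    (a + c) % N              ≡⟨ %-distribˡ-+ a c N ⟩
    (a % N + c % N) % N      ≡⟨ cong₂ (λ x y → (x + y) % N) p q ⟩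
    (b % N + d % N) % N      ≡⟨ %-distribˡ-+ b d N ⟨
    (b + d) % N              ∎)
    where open ≡-Reasoning

  *-cong : ∀ {a b c d} → a ≋ b → c ≋ d → a * c ≋ b * d
  *-cong {a} {b} {c} {d} (mk≋ p) (mk≋ q) = mk≋ (begin
    (a * c) % N              ≡⟨ %-distribˡ-* a c N ⟩
    (a % N * (c % N)) % N    ≡⟨ cong₂ (λ x y → (x * y) % N) p q ⟩
    (b % N * (d % N)) % N    ≡⟨ %-distribˡ-* b d N ⟨
    (b * d) % N              ∎)
    where open ≡-Reasoning

  m%N≋m : ∀ a → a % N ≋ a
  m%N≋m a = mk≋ (m%n%n≡m%n a N)

  m+kN≋m : ∀ a k → a + k * N ≋ a
  m+kN≋m a k = mk≋ ([m+kn]%n≡m%n a k N)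

  0%N≡0 : 0 % N ≡ 0
  0%N≡0 = m<n⇒m%n≡m (>-nonZero⁻¹ N)

  N≋0 : N ≋ 0
  N≋0 = mk≋ (trans (n%n≡0 N) (sym 0%N≡0))

  m+N≋m : ∀ a → a + N ≋ a
  m+N≋m a = ≋-trans (+-cong (≋-refl {a}) N≋0) (≋-reflexive (+-comm a 0))

  +-cancelʳ : ∀ {a b} c → a + c ≋ b + c → a ≋ b
  +-cancelʳ {a} {b} c h = begin
      a                     ≈⟨ m+kN≋m a c ⟨
      a + c * N             ≡⟨ shift a ⟩
      a + c + c * pred N    ≈⟨ +-cong h ≋-refl ⟩
      b + c + c * pred N    ≡⟨ shift b ⟨
      b + c * N             ≈⟨ m+kN≋m b c ⟩
      b                     ∎
    where
    open ≋-Reasoning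
    shift : ∀ x → x + c * N ≡ x + c + c * pred N
    shift x = trans (cong (λ n → x + c * n) (sym (suc-pred N))) (lemma x c (pred N))
      where
      lemma : ∀ x c p → x + c * suc p ≡ x + c + c * p
      lemma = solve-∀

  ∣⇒≋0 : ∀ {a} → N ∣ a → a ≋ 0
  ∣⇒≋0 {a} N∣a = mk≋ (trans (n∣m⇒m%n≡0 a N N∣a) (sym 0%N≡0))

  ≋0⇒∣ : ∀ {a} → a ≋ 0 → N ∣ a
  ≋0⇒∣ {a} (mk≋ p) = m%n≡0⇒n∣m a N (trans p 0%N≡0)

  *-cancelˡ-≋ : ∀ {t d a b} → t * d ≋ 1 → t * a ≋ t * b → a ≋ b
  *-cancelˡ-≋ {t} {d} {a} {b} t*d≋1 ta≋tb = begin
      a              ≡⟨ *-identityˡ a ⟨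
      1 * a          ≈⟨ *-cong t*d≋1 ≋-refl ⟨
      t * d * a      ≡⟨ swap t d a ⟩
      d * (t * a)    ≈⟨ *-cong (≋-refl {d}) ta≋tb ⟩
      d * (t * b)    ≡⟨ swap t d b ⟨
      t * d * b      ≈⟨ *-cong t*d≋1 ≋-refl ⟩
      1 * b          ≡⟨ *-identityˡ b ⟩
      b              ∎
    where
    open ≋-Reasoning
    swap : ∀ t d a → t * d * a ≡ d * (t * a)
    swap = solve-∀

  ≋⇒≡ : ∀ {a b} → a < N → b < N → a ≋ b → a ≡ b
  ≋⇒≡ a<N b<N (mk≋ p) = trans (sym (m<n⇒m%n≡m a<N)) (trans p (m<n⇒m%n≡m b<N))

  +-≋-cases : ∀ {a b c} → a < N → b < N → c < N → a + b ≋ c → a + b ≡ c ⊎ a + b ≡ c + N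
  +-≋-cases {a} {b} {c} a<N b<N c<N h with a + b <? N
  ... | yes a+b<N = inj₁ (≋⇒≡ a+b<N c<N h)
  ... | no a+b≮N = inj₂ (begin
      a + b              ≡⟨ m∸n+n≡m N≤a+b ⟨
      (a + b ∸ N) + N    ≡⟨ cong (_+ N) (≋⇒≡ overflow<N c<N overflow≋c) ⟩
      c + N              ∎)
    where
    open ≡-Reasoning
    N≤a+b = ≮⇒≥ a+b≮N
    overflow≋c : a + b ∸ N ≋ c
    overflow≋c = ≋-trans (≋-sym (m+N≋m _)) (≋-trans (≋-reflexive (m∸n+n≡m N≤a+b)) h)
    overflow<N : a + b ∸ N < N
    overflow<N = +-cancelʳ-< _ _ N (subst (_< N + N) (sym (m∸n+n≡m N≤a+b)) (+-mono-< a<N b<N))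

module ZMod (N : ℕ) {{_ : NonZero N}} where

  open Congruence N public

  toℕ-[] : ∀ a → toℕ ([_]ₙ {N} a) ≡ a % N
  toℕ-[] a = toℕ-fromℕ< (m%n<n a N)

  toℕ-[]-≋ : ∀ a → toℕ ([_]ₙ {N} a) ≋ a
  toℕ-[]-≋ a = ≋-trans (≋-reflexive (toℕ-[] a)) (m%N≋m a)

  toℕ-⊕ : ∀ (x y : Fin N) → toℕ (x ⊕ y) ≋ toℕ x + toℕ y
  toℕ-⊕ x y = toℕ-[]-≋ (toℕ x + toℕ y)

  toℕ-≋-injective : ∀ {x y : Fin N} → toℕ x ≋ toℕ y → x ≡ y
  toℕ-≋-injective {x} {y} h = toℕ-injective (≋⇒≡ (toℕ<n x) (toℕ<n y) h)

  ⊕-≡ : ∀ (x y : Fin N) {z} → toℕ x + toℕ y ≋ toℕ z → x ⊕ y ≡ z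
  ⊕-≡ x y h = toℕ-≋-injective (≋-trans (toℕ-⊕ x y) h)

  0ₙ : Fin N
  0ₙ = [ 0 ]ₙ

  toℕ-0ₙ : toℕ 0ₙ ≡ 0
  toℕ-0ₙ = trans (toℕ-[] 0) 0%N≡0

  infix 8 ⊖_
  ⊖_ : Fin N → Fin N
  ⊖ x = [ N ∸ toℕ x ]ₙ

  ⊕-comm : ∀ (x y : Fin N) → x ⊕ y ≡ y ⊕ x
  ⊕-comm x y = ⊕-≡ x y (≋-trans (≋-reflexive (+-comm (toℕ x) (toℕ y))) (≋-sym (toℕ-⊕ y x)))

  ⊕-assoc : ∀ (x y z : Fin N) → (x ⊕ y) ⊕ z ≡ x ⊕ (y ⊕ z)
  ⊕-assoc x y z = ⊕-≡ (x ⊕ y) z (begin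
      toℕ (x ⊕ y) + toℕ z        ≈⟨ +-cong (toℕ-⊕ x y) ≋-refl ⟩
      toℕ x + toℕ y + toℕ z      ≡⟨ +-assoc (toℕ x) (toℕ y) (toℕ z) ⟩
      toℕ x + (toℕ y + toℕ z)    ≈⟨ +-cong ≋-refl (toℕ-⊕ y z) ⟨
      toℕ x + toℕ (y ⊕ z)        ≈⟨ toℕ-⊕ x (y ⊕ z) ⟨
      toℕ (x ⊕ (y ⊕ z))          ∎)
    where open ≋-Reasoning

  ⊕-identityˡ : ∀ (x : Fin N) → 0ₙ ⊕ x ≡ x
  ⊕-identityˡ x = ⊕-≡ 0ₙ x (≋-reflexive (cong (_+ toℕ x) toℕ-0ₙ))

  ⊕-identityʳ : ∀ (x : Fin N) → x ⊕ 0ₙ ≡ x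
  ⊕-identityʳ x = trans (⊕-comm x 0ₙ) (⊕-identityˡ x)

  ⊖-inverseˡ : ∀ (x : Fin N) → ⊖ x ⊕ x ≡ 0ₙ
  ⊖-inverseˡ x = ⊕-≡ (⊖ x) x (begin
      toℕ (⊖ x) + toℕ x          ≈⟨ +-cong (toℕ-[]-≋ (N ∸ toℕ x)) ≋-refl ⟩
      N ∸ toℕ x + toℕ x          ≡⟨ m∸n+n≡m (<⇒≤ (toℕ<n x)) ⟩
      N                          ≈⟨ N≋0 ⟩
      0                          ≡⟨ toℕ-0ₙ ⟨
      toℕ 0ₙ                     ∎)
    where open ≋-Reasoning

  ⊖-inverseʳ : ∀ (x : Fin N) → x ⊕ ⊖ x ≡ 0ₙ
  ⊖-inverseʳ x = trans (⊕-comm x (⊖ x)) (⊖-inverseˡ x)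

  ⊕-isAbelianGroup : IsAbelianGroup _≡_ _⊕_ 0ₙ ⊖_
  ⊕-isAbelianGroup = record
    { isGroup = record
      { isMonoid = record
        { isSemigroup = record
          { isMagma = record { isEquivalence = isEquivalence ; ∙-cong = cong₂ _⊕_ }
          ; assoc = ⊕-assoc
          }
        ; identity = ⊕-identityˡ , ⊕-identityʳ
        }
      ; inverse = ⊖-inverseˡ , ⊖-inverseʳ
      ; ⁻¹-cong = cong ⊖_
      }
    ; comm = ⊕-comm
    }

  open AbelianGroupColourings ⊕-isAbelianGroup public

%2-cases : ∀ n → n % 2 ≡ 0 ⊎ n % 2 ≡ 1
%2-cases n = n≤1⇒n≡0∨n≡1 (≤-pred (m%n<n n 2))

even⇒≡double : ∀ {n} → n % 2 ≡ 0 → n ≡ n / 2 + n / 2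
even⇒≡double {n} n%2≡0 = trans (m≡m%n+[m/n]*n n 2) (trans (cong (_+ n / 2 * 2) n%2≡0) (double (n / 2)))
  where
  double : ∀ m → 0 + m * 2 ≡ m + m
  double = solve-∀

odd⇒≡suc-double : ∀ {n} → n % 2 ≡ 1 → n ≡ suc (n / 2 + n / 2)
odd⇒≡suc-double {n} n%2≡1 = trans (m≡m%n+[m/n]*n n 2) (trans (cong (_+ n / 2 * 2) n%2≡1) (double (n / 2)))
  where
  double : ∀ m → 1 + m * 2 ≡ suc (m + m)
  double = solve-∀

divisor-of-odd : ∀ {d n} → d ∣ n → n % 2 ≡ 1 → d % 2 ≡ 1
divisor-of-odd {d} {n} d∣n n%2≡1 with %2-cases d
... | inj₂ d%2≡1 = d%2≡1
... | inj₁ d%2≡0 with () ← trans (sym (n∣m⇒m%n≡0 n 2 (∣-trans (m%n≡0⇒n∣m d 2 d%2≡0) d∣n))) n%2≡1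

module _ {m g N : ℕ} {{_ : NonZero m}} {{_ : NonZero g}} {{_ : NonZero N}} (m*g≡N : m * g ≡ N) where

  private
    module Mod-m = Congruence m
    module Mod-N = Congruence N
    instance
      m*g≢0 : NonZero (m * g)
      m*g≢0 = m*n≢0 m g

    %m*g : ∀ a → a % m * g ≡ a * g % N
    %m*g a = trans (m%n*o≡m*o%[n*o] a m g) (%-congʳ m*g≡N)

  ≋-*-cancelʳ : ∀ {a b} → a * g Mod-N.≋ b * g → a Mod-m.≋ b
  ≋-*-cancelʳ {a} {b} (Mod-N.mk≋ p) =
    Mod-m.mk≋ (*-cancelʳ-≡ (a % m) (b % m) g (trans (%m*g a) (trans p (sym (%m*g b)))))

  ≋-*-congʳ : ∀ {a b} → a Mod-m.≋ b → a * g Mod-N.≋ b * g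
  ≋-*-congʳ {a} {b} (Mod-m.mk≋ p) = Mod-N.mk≋ (trans (sym (%m*g a)) (trans (cong (_* g) p) (%m*g b)))

module _ {g N : ℕ} {{_ : NonZero g}} {{_ : NonZero N}} (g∣N : g ∣ N) where

  private
    module Mod-g = Congruence g
    module Mod-N = Congruence N

  ≋-divisor : ∀ {a b} → a Mod-N.≋ b → a Mod-g.≋ b
  ≋-divisor {a} {b} (Mod-N.mk≋ p) =
    Mod-g.mk≋ (trans (sym (m∣n⇒o%n%m≡o%m g N a g∣N)) (trans (cong (_% g) p) (m∣n⇒o%n%m≡o%m g N b g∣N)))

module _ (m : ℕ) {{_ : NonZero m}} where

  open Congruence m

  coprime⇒inverse : ∀ {d} → Coprime d m → ∃ λ t → t * d ≋ 1
  coprime⇒inverse {d} d⊥m with Bézout.identity (coprime⇒GCD≡1 d⊥m)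
  ... | Bézout.+- t y 1+y*m≡t*d = t , ≋-trans (≋-reflexive (sym 1+y*m≡t*d)) (m+kN≋m 1 y)
  -- t * d ≡ -1, so (m - 1) * t inverts d
  ... | Bézout.-+ t y 1+t*d≡y*m = pred m * t , +-cancelʳ (pred m) (begin
      pred m * t * d + pred m    ≡⟨ factor (pred m) t d ⟩
      pred m * (1 + t * d)       ≡⟨ cong (pred m *_) 1+t*d≡y*m ⟩
      pred m * (y * m)           ≡⟨ regroup (pred m) y m ⟩
      0 + y * pred m * m         ≈⟨ m+kN≋m 0 (y * pred m) ⟩
      0                          ≈⟨ N≋0 ⟨
      m                          ≡⟨ suc-pred m ⟨
      1 + pred m                 ∎)
    where
    open ≋-Reasoning
    factor : ∀ a b c → a * b * c + a ≡ a * (1 + b * c)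
    factor = solve-∀
    regroup : ∀ p y m → p * (y * m) ≡ 0 + y * p * m
    regroup = solve-∀

-- Odd moduli

≤-separates-odd-sum : ∀ {k j j′} → j + j′ ≡ suc (k + k) → ⌊ j ≤? k ⌋ ≢ ⌊ j′ ≤? k ⌋
≤-separates-odd-sum {k} {j} {j′} sum with j ≤? k | j′ ≤? k
... | yes j≤k | yes j′≤k = λ _ → <-irrefl sum (s≤s (+-mono-≤ j≤k j′≤k))
... | no j≰k  | no j′≰k  = λ _ → <-irrefl (sym sum)
      (subst (_≤ j + j′) (cong suc (+-suc k k)) (+-mono-≤ (≰⇒> j≰k) (≰⇒> j′≰k)))
... | yes _   | no _     = λ ()
... | no _    | yes _    = λ ()

≤-separates-even-sum : ∀ {h j j′} → j ≢ j′ → j + j′ ≡ suc h + suc h →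
                       ⌊ j ≤? h ⌋ ≢ ⌊ j′ ≤? h ⌋
≤-separates-even-sum {h} {j} {j′} j≢j′ sum with j ≤? h | j′ ≤? h
... | yes j≤h | yes j′≤h = λ _ → <-irrefl sum
      (≤-trans (s≤s (+-mono-≤ j≤h j′≤h)) (s≤s (subst (h + h ≤_) (sym (+-suc h h)) (n≤1+n (h + h)))))
... | no j≰h  | no j′≰h  = λ _ → j≢j′ (trans (halfway (≰⇒> j≰h) (≰⇒> j′≰h) sum)
                                           (sym (halfway (≰⇒> j′≰h) (≰⇒> j≰h) (trans (+-comm j′ j) sum))))
  where
  halfway : ∀ {a b} → suc h ≤ a → suc h ≤ b → a + b ≡ suc h + suc h → a ≡ suc h
  halfway {a} {b} sh≤a sh≤b a+b≡ =
    ≤-antisym (+-cancelʳ-≤ b a (suc h) (≤-trans (≤-reflexive a+b≡) (+-monoʳ-≤ (suc h) sh≤b))) sh≤a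
... | yes _   | no _     = λ ()
... | no _    | yes _    = λ ()

inInterval : ℕ → ℕ → Bool
inInterval h zero    = false
inInterval h (suc j) = ⌊ suc j ≤? h ⌋

private
  zero-separated : ∀ {h s j} → s ≤ 1 → j < suc (h + h) → 0 ≢ j →
                   j ≡ s ⊎ j ≡ s + suc (h + h) → false ≢ inInterval h j
  zero-separated {_}     {_} {zero}  _ _ 0≢j _ = ⊥-elim (0≢j refl)
  zero-separated {zero}  {_} {suc _} _ (s≤s ()) _ _
  zero-separated {suc h} {suc zero} {suc zero} _ _ _ (inj₁ refl) = λ ()
  zero-separated {suc h} {suc zero} {suc (suc _)} _ _ _ (inj₁ ())
  zero-separated {suc h} {zero} {suc _} _ _ _ (inj₁ ())
  zero-separated {suc h} {suc (suc _)} {suc _} (s≤s ()) _ _ (inj₁ _)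
  zero-separated {suc h} {s} {suc j} _ j<m _ (inj₂ j≡) =
    ⊥-elim (<⇒≱ j<m (subst (suc (suc h + suc h) ≤_) (sym j≡) (m≤n+m _ s)))

interval-separates : ∀ {h s j j′} → s ≤ 1 → j < suc (h + h) → j′ < suc (h + h) → j ≢ j′ →
                     j + j′ ≡ s ⊎ j + j′ ≡ s + suc (h + h) → inInterval h j ≢ inInterval h j′
interval-separates {j = zero} s≤1 _ j′<m j≢j′ sum = zero-separated s≤1 j′<m j≢j′ sum
interval-separates {j = suc j} {zero} s≤1 j<m _ j≢j′ sum =
  zero-separated s≤1 j<m (j≢j′ ∘ sym) (map unpad unpad sum) ∘ sym
  where
  unpad : ∀ {a} → suc j + 0 ≡ a → suc j ≡ a
  unpad = trans (sym (+-identityʳ (suc j)))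
interval-separates {s = zero} {suc _} {suc _} _ _ _ _ (inj₁ ())
interval-separates {s = suc zero} {suc j} {suc j′} _ _ _ _ (inj₁ sum)
  with () ← trans (sym (+-suc j j′)) (suc-injective sum)
interval-separates {s = zero} {suc _} {suc _} _ _ _ _ (inj₂ sum) = ≤-separates-odd-sum sum
interval-separates {h} {suc zero} {suc _} {suc _} _ _ _ j≢j′ (inj₂ sum) =
  ≤-separates-even-sum j≢j′ (trans sum (cong suc (sym (+-suc h h))))
interval-separates {s = suc (suc _)} (s≤s ()) _ _ _ _

module OddModulusColouring (N : ℕ) {{_ : NonZero N}} (N-odd : N % 2 ≡ 1) (D : ℕ) where

  open Congruence N

  g : ℕ
  g = gcd D N

  instance
    g≢0 : NonZero g
    g≢0 = ≢-nonZero (gcd[m,n]≢0 D N (inj₂ (≢-nonZero⁻¹ N)))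

  m d′ : ℕ
  m = N / g
  d′ = D / g

  m*g≡N : m * g ≡ N
  m*g≡N = m/n*n≡m (gcd[m,n]∣n D N)

  d′*g≡D : d′ * g ≡ D
  d′*g≡D = m/n*n≡m (gcd[m,n]∣m D N)

  instance
    m≢0 : NonZero m
    m≢0 = ≢-nonZero (λ m≡0 → ≢-nonZero⁻¹ N (trans (sym m*g≡N) (cong (_* g) m≡0)))

  private
    module Mod-m = Congruence m
    module Mod-g = Congruence g

  k h : ℕ
  k = g / 2
  h = m / 2

  g≡ : g ≡ suc (k + k)
  g≡ = odd⇒≡suc-double (divisor-of-odd (gcd[m,n]∣n D N) N-odd)

  m≡ : m ≡ suc (h + h)
  m≡ = odd⇒≡suc-double (divisor-of-odd (divides g (trans (sym m*g≡N) (*-comm m g))) N-odd)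

  t : ℕ
  t = proj₁ (coprime⇒inverse m (coprime-/gcd D N))

  t*d′≋1 : t * d′ Mod-m.≋ 1
  t*d′≋1 = proj₂ (coprime⇒inverse m (coprime-/gcd D N))

  -- Non-multiples: the residues of X and −X mod g add up to g = 2k + 1, so exactly
  -- one of them is at most k.  Multiples of g form a cyclic group of order m in
  -- which D has index d′, and t re-indexes it so that D has index 1.
  colour : ℕ → Bool
  colour X with g ∣? X
  ... | yes _ = inInterval h (t * (X / g) % m)
  ... | no _  = ⌊ X % g ≤? k ⌋

  private
    g∣sum : ∀ {X Y s} → X + Y ≋ s * D → g ∣ X + Y
    g∣sum {s = s} sum = Mod-g.≋0⇒∣ (Mod-g.≋-trans (≋-divisor (gcd[m,n]∣n D N) sum)
                                                 (Mod-g.∣⇒≋0 (∣-trans (gcd[m,n]∣m D N) (n∣m*n s))))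

    quotient<m : ∀ {X} → X < N → X / g < m
    quotient<m {X} X<N = m<n*o⇒m/o<n (subst (X <_) (sym m*g≡N) X<N)

    index<m : ∀ X → t * (X / g) % m < suc (h + h)
    index<m X = subst (t * (X / g) % m <_) m≡ (m%n<n (t * (X / g)) m)

  residues-separated : ∀ {X Y} → ¬ g ∣ X → g ∣ X + Y → ⌊ X % g ≤? k ⌋ ≢ ⌊ Y % g ≤? k ⌋
  residues-separated {X} {Y} g∤X g∣X+Y
    with Mod-g.+-≋-cases (m%n<n X g) (m%n<n Y g) (>-nonZero⁻¹ g)
           (Mod-g.≋-trans (Mod-g.+-cong (Mod-g.m%N≋m X) (Mod-g.m%N≋m Y)) (Mod-g.∣⇒≋0 g∣X+Y))
  ... | inj₁ r+r′≡0 = ⊥-elim (g∤X (m%n≡0⇒n∣m X g (m+n≡0⇒m≡0 (X % g) r+r′≡0)))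
  ... | inj₂ r+r′≡g = ≤-separates-odd-sum (trans r+r′≡g g≡)

  multiples-separated : ∀ {s X Y} → s ≤ 1 → X < N → Y < N → X ≢ Y → X + Y ≋ s * D →
                        g ∣ X → g ∣ Y →
                        inInterval h (t * (X / g) % m) ≢ inInterval h (t * (Y / g) % m)
  multiples-separated {s} {X} {Y} s≤1 X<N Y<N X≢Y sum g∣X g∣Y =
    interval-separates (≤-trans (m%n≤m s m) s≤1) (index<m X) (index<m Y) j≢j′
      (subst (λ n → t * q % m + t * q′ % m ≡ s % m ⊎ t * q % m + t * q′ % m ≡ s % m + n) m≡
        (Mod-m.+-≋-cases (m%n<n _ m) (m%n<n _ m) (m%n<n s m) j+j′≋s))
    where
    q q′ : ℕ
    q = X / g
    q′ = Y / g
    q+q′≋sd′ : q + q′ Mod-m.≋ s * d′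
    q+q′≋sd′ = ≋-*-cancelʳ m*g≡N (begin
        (q + q′) * g        ≡⟨ *-distribʳ-+ g q q′ ⟩
        q * g + q′ * g      ≡⟨ cong₂ _+_ (m/n*n≡m g∣X) (m/n*n≡m g∣Y) ⟩
        X + Y               ≈⟨ sum ⟩
        s * D               ≡⟨ cong (s *_) d′*g≡D ⟨
        s * (d′ * g)        ≡⟨ *-assoc s d′ g ⟨
        s * d′ * g          ∎)
      where open ≋-Reasoning
    j+j′≋s : t * q % m + t * q′ % m Mod-m.≋ s % m
    j+j′≋s = begin
        t * q % m + t * q′ % m    ≈⟨ Mod-m.+-cong (Mod-m.m%N≋m (t * q)) (Mod-m.m%N≋m (t * q′)) ⟩
        t * q + t * q′            ≡⟨ *-distribˡ-+ t q q′ ⟨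
        t * (q + q′)              ≈⟨ Mod-m.*-cong (Mod-m.≋-refl {t}) q+q′≋sd′ ⟩
        t * (s * d′)              ≡⟨ *-comm t (s * d′) ⟩
        s * d′ * t                ≡⟨ *-assoc s d′ t ⟩
        s * (d′ * t)              ≡⟨ cong (s *_) (*-comm d′ t) ⟩
        s * (t * d′)              ≈⟨ Mod-m.*-cong (Mod-m.≋-refl {s}) t*d′≋1 ⟩
        s * 1                     ≡⟨ *-identityʳ s ⟩
        s                         ≈⟨ Mod-m.m%N≋m s ⟨
        s % m                     ∎
      where open Mod-m.≋-Reasoning
    j≢j′ : t * q % m ≢ t * q′ % m
    j≢j′ j≡j′ = X≢Y (trans (sym (m/n*n≡m g∣X)) (trans (cong (_* g) q≡q′) (m/n*n≡m g∣Y)))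
      where
      open Mod-m.≋-Reasoning
      q≡q′ : q ≡ q′
      q≡q′ = Mod-m.≋⇒≡ (quotient<m X<N) (quotient<m Y<N)
        (Mod-m.*-cancelˡ-≋ {t} {d′} {q} {q′} t*d′≋1 (begin
          t * q         ≈⟨ Mod-m.m%N≋m (t * q) ⟨
          t * q % m     ≡⟨ j≡j′ ⟩
          t * q′ % m    ≈⟨ Mod-m.m%N≋m (t * q′) ⟩
          t * q′        ∎))

  colour-separates : ∀ {s X Y} → s ≤ 1 → X < N → Y < N → X ≢ Y → X + Y ≋ s * D → colour X ≢ colour Y
  colour-separates {s} {X} {Y} s≤1 X<N Y<N X≢Y sum with g ∣? X | g ∣? Y
  ... | yes g∣X | yes g∣Y = multiples-separated s≤1 X<N Y<N X≢Y sum g∣X g∣Y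
  ... | no g∤X  | no _    = residues-separated g∤X (g∣sum {X} {Y} {s} sum)
  ... | yes g∣X | no g∤Y  = ⊥-elim (g∤Y (∣m+n∣m⇒∣n (g∣sum {X} {Y} {s} sum) g∣X))
  ... | no g∤X  | yes g∣Y =
    ⊥-elim (g∤X (∣m+n∣m⇒∣n (subst (g ∣_) (+-comm X Y) (g∣sum {X} {Y} {s} sum)) g∣Y))

module OddModulus {N : ℕ} {{_ : NonZero N}} (N-odd : N % 2 ≡ 1) where

  open ZMod N

  all-even : ∀ (u : Fin N) → Even u
  all-even u = [ halve (toℕ u) ≋-refl , halve (toℕ u + N) (m+N≋m (toℕ u)) ∘ u+N-even ]′ (%2-cases (toℕ u))
    where
    halve : ∀ t → t ≋ toℕ u → t % 2 ≡ 0 → Even u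
    halve t t≋u t-even = [ t / 2 ]ₙ , ⊕-≡ [ t / 2 ]ₙ [ t / 2 ]ₙ (begin
        toℕ [ t / 2 ]ₙ + toℕ [ t / 2 ]ₙ    ≈⟨ +-cong (toℕ-[]-≋ (t / 2)) (toℕ-[]-≋ (t / 2)) ⟩
        t / 2 + t / 2                      ≡⟨ even⇒≡double t-even ⟨
        t                                  ≈⟨ t≋u ⟩
        toℕ u                              ∎)
      where open ≋-Reasoning
    u+N-even : toℕ u % 2 ≡ 1 → (toℕ u + N) % 2 ≡ 0
    u+N-even u-odd = trans (%-distribˡ-+ (toℕ u) N 2) (cong₂ (λ a b → (a + b) % 2) u-odd N-odd)

  avoids-pair : ∀ (u v : Fin N) → ∃ λ χ → Avoids _⊕_ χ u × Avoids _⊕_ χ v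
  avoids-pair u v with all-even u
  ... | c , c⊕c≡u = (λ z → colour (toℕ (z - c))) , avoids-u , avoids-v
    where
    open OddModulusColouring N N-odd (toℕ (v - u))
    colour-avoids : ∀ s → s ≤ 1 → ∀ w → toℕ w ≋ s * toℕ (v - u) → Avoids _⊕_ (colour ∘ toℕ) w
    colour-avoids s s≤1 w w≋ x y x≢y sum =
      colour-separates s≤1 (toℕ<n x) (toℕ<n y) (x≢y ∘ toℕ-injective)
        (≋-trans (≋-sym (toℕ-⊕ x y)) (≋-trans (≋-reflexive (cong toℕ sum)) w≋))
    avoids-u : Avoids _⊕_ (λ z → colour (toℕ (z - c))) u
    avoids-u = subst (Avoids _⊕_ _) (trans (⊕-identityˡ (c ⊕ c)) c⊕c≡u)
                 (avoids-translate {c = c} (colour-avoids 0 z≤n 0ₙ (≋-reflexive toℕ-0ₙ)))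
    avoids-v : Avoids _⊕_ (λ z → colour (toℕ (z - c))) v
    avoids-v = subst (Avoids _⊕_ _) (trans (cong ((v - u) ⊕_) c⊕c≡u) ([x-y]∙y≡x v u))
                 (avoids-translate {c = c}
                   (colour-avoids 1 (s≤s z≤n) (v - u) (≋-reflexive (+-comm 0 (toℕ (v - u))))))

  maximal-Pair : ∀ {a b} → a ≢ b → Maximal _⊕_ (Pair a b)
  maximal-Pair {a} {b} a≢b χ χ-avoids z χz = decidable-stable (pair? a b z) λ z∉P →
    triangle (χ-avoids a (inj₁ refl)) χz (χ-avoids b (inj₂ refl)) (z∉P ∘ inj₁ ∘ sym) (z∉P ∘ inj₂) a≢b
             (double⇒midpoint a b z (all-even _))

  avoided-within-pair : ∀ {χ} {U : Subset N} → NonConstant _⊕_ χ → (∀ u → u ∈ U → Avoids _⊕_ χ u) →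
                        ∃₂ λ a b → a ≢ b × ∀ z → z ∈ U → Pair a b z
  avoided-within-pair {χ} {U} (x , y , χx , χy) χ-avoids = within (witnesses (_∈? U))
    where
    x≢y : x ≢ y
    x≢y refl with () ← trans (sym χx) χy
    partner : ∀ a → Dec (a ≡ x) → ∃ λ b → a ≢ b
    partner a (yes refl) = y , x≢y
    partner a (no a≢x)   = x , a≢x
    within : Witnesses (_∈ U) → ∃₂ λ a b → a ≢ b × ∀ z → z ∈ U → Pair a b z
    within (none ∄) = x , y , x≢y , λ z z∈U → ⊥-elim (∄ z z∈U)
    within (unique a _ only-a) =
      let (b , a≢b) = partner a (a ≟ x) in a , b , a≢b , λ z z∈U → inj₁ (only-a z z∈U)
    within (two a b a∈U b∈U a≢b) = a , b , a≢b , λ z z∈U →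
      decidable-stable (pair? a b z) λ z∉P →
        triangle (χ-avoids a a∈U) (χ-avoids z z∈U) (χ-avoids b b∈U) (z∉P ∘ inj₁ ∘ sym) (z∉P ∘ inj₂) a≢b
                 (double⇒midpoint a b z (all-even _))

-- Even moduli: colourings by halving

module Halving {N M : ℕ} {{_ : NonZero N}} {{_ : NonZero M}} (N≡M+M : N ≡ M + M) where

  private
    module ℤN = ZMod N
    module ℤM = ZMod M

    M*2≡N : M * 2 ≡ N
    M*2≡N = trans (double M) (sym N≡M+M)
      where
      double : ∀ m → m * 2 ≡ m + m
      double = solve-∀

  1ₘ : Fin M
  1ₘ = [ 1 ]ₙ

  -- Opaque: unfolded, ι₀ a normalises to a numeral, and a could no longer be
  -- inferred from a hypothesis ι₀ a ≡ ι₀ b.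
  opaque
    ι₀ ι₁ : Fin M → Fin N
    ι₀ y = [ toℕ y * 2 ]ₙ
    ι₁ y = [ 1 + toℕ y * 2 ]ₙ

    toℕ-ι₀ : ∀ y → toℕ (ι₀ y) ≡ toℕ y * 2
    toℕ-ι₀ y = trans (ℤN.toℕ-[] _) (m<n⇒m%n≡m (subst (toℕ y * 2 <_) M*2≡N (*-monoˡ-< 2 (toℕ<n y))))

    toℕ-ι₁ : ∀ y → toℕ (ι₁ y) ≡ 1 + toℕ y * 2
    toℕ-ι₁ y = trans (ℤN.toℕ-[] _) (m<n⇒m%n≡m (subst (1 + toℕ y * 2 <_) M*2≡N (*-monoˡ-≤ 2 (toℕ<n y))))

  ι₀-injective : ∀ {a b} → ι₀ a ≡ ι₀ b → a ≡ b
  ι₀-injective {a} {b} eq = toℕ-injective (*-cancelʳ-≡ (toℕ a) (toℕ b) 2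
    (trans (sym (toℕ-ι₀ a)) (trans (cong toℕ eq) (toℕ-ι₀ b))))

  ι₁-injective : ∀ {a b} → ι₁ a ≡ ι₁ b → a ≡ b
  ι₁-injective {a} {b} eq = toℕ-injective (*-cancelʳ-≡ (toℕ a) (toℕ b) 2
    (suc-injective (trans (sym (toℕ-ι₁ a)) (trans (cong toℕ eq) (toℕ-ι₁ b)))))

  ι₀≢ι₁ : ∀ {a b} → ι₀ a ≢ ι₁ b
  ι₀≢ι₁ {a} {b} eq with () ← trans (sym (m*n%n≡0 (toℕ a) 2))
      (trans (cong (_% 2) (trans (sym (toℕ-ι₀ a)) (trans (cong toℕ eq) (toℕ-ι₁ b))))
             ([m+kn]%n≡m%n 1 (toℕ b) 2))

  private
    halve : Fin N → Fin M
    halve x = [ toℕ x / 2 ]ₙ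

    toℕ-halve : ∀ x → toℕ (halve x) ≡ toℕ x / 2
    toℕ-halve x = trans (ℤM.toℕ-[] _) (m<n⇒m%n≡m (m<n*o⇒m/o<n (subst (toℕ x <_) (sym M*2≡N) (toℕ<n x))))

    toℕ-by-halves : ∀ x r → toℕ x % 2 ≡ r → toℕ x ≡ r + toℕ (halve x) * 2
    toℕ-by-halves x r x%2≡r =
      trans (m≡m%n+[m/n]*n (toℕ x) 2) (cong₂ (λ r q → r + q * 2) x%2≡r (sym (toℕ-halve x)))

  ι-split : ∀ x → (∃ λ y → x ≡ ι₀ y) ⊎ (∃ λ y → x ≡ ι₁ y)
  ι-split x with %2-cases (toℕ x)
  ... | inj₁ x-even =
    inj₁ (halve x , toℕ-injective (trans (toℕ-by-halves x 0 x-even) (sym (toℕ-ι₀ (halve x)))))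
  ... | inj₂ x-odd  =
    inj₂ (halve x , toℕ-injective (trans (toℕ-by-halves x 1 x-odd) (sym (toℕ-ι₁ (halve x)))))

  private
    scaled : ∀ {a} {b : Fin M} → a ℤM.≋ toℕ b → a * 2 ℤN.≋ toℕ b * 2
    scaled = ≋-*-congʳ M*2≡N

  ι₀-⊕-ι₀ : ∀ a b → ι₀ a ⊕ ι₀ b ≡ ι₀ (a ⊕ b)
  ι₀-⊕-ι₀ a b = ℤN.⊕-≡ (ι₀ a) (ι₀ b) (begin
      toℕ (ι₀ a) + toℕ (ι₀ b)     ≡⟨ cong₂ _+_ (toℕ-ι₀ a) (toℕ-ι₀ b) ⟩
      toℕ a * 2 + toℕ b * 2       ≡⟨ *-distribʳ-+ 2 (toℕ a) (toℕ b) ⟨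
      (toℕ a + toℕ b) * 2         ≈⟨ scaled (ℤM.≋-sym (ℤM.toℕ-⊕ a b)) ⟩
      toℕ (a ⊕ b) * 2             ≡⟨ toℕ-ι₀ (a ⊕ b) ⟨
      toℕ (ι₀ (a ⊕ b))            ∎)
    where open ℤN.≋-Reasoning

  ι₀-⊕-ι₁ : ∀ a b → ι₀ a ⊕ ι₁ b ≡ ι₁ (a ⊕ b)
  ι₀-⊕-ι₁ a b = ℤN.⊕-≡ (ι₀ a) (ι₁ b) (begin
      toℕ (ι₀ a) + toℕ (ι₁ b)     ≡⟨ cong₂ _+_ (toℕ-ι₀ a) (toℕ-ι₁ b) ⟩
      toℕ a * 2 + (1 + toℕ b * 2) ≡⟨ regroup (toℕ a) (toℕ b) ⟩
      1 + (toℕ a + toℕ b) * 2     ≈⟨ ℤN.+-cong (ℤN.≋-refl {1}) (scaled (ℤM.≋-sym (ℤM.toℕ-⊕ a b))) ⟩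
      1 + toℕ (a ⊕ b) * 2         ≡⟨ toℕ-ι₁ (a ⊕ b) ⟨
      toℕ (ι₁ (a ⊕ b))            ∎)
    where
    open ℤN.≋-Reasoning
    regroup : ∀ a b → a * 2 + (1 + b * 2) ≡ 1 + (a + b) * 2
    regroup = solve-∀

  ι₁-⊕-ι₁ : ∀ a b → ι₁ a ⊕ ι₁ b ≡ ι₀ (a ⊕ b ⊕ 1ₘ)
  ι₁-⊕-ι₁ a b = ℤN.⊕-≡ (ι₁ a) (ι₁ b) (begin
      toℕ (ι₁ a) + toℕ (ι₁ b)            ≡⟨ cong₂ _+_ (toℕ-ι₁ a) (toℕ-ι₁ b) ⟩
      (1 + toℕ a * 2) + (1 + toℕ b * 2)  ≡⟨ regroup (toℕ a) (toℕ b) ⟩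
      (toℕ a + toℕ b + 1) * 2            ≈⟨ scaled a+b+1≋ ⟩
      toℕ (a ⊕ b ⊕ 1ₘ) * 2               ≡⟨ toℕ-ι₀ (a ⊕ b ⊕ 1ₘ) ⟨
      toℕ (ι₀ (a ⊕ b ⊕ 1ₘ))              ∎)
    where
    open ℤN.≋-Reasoning
    regroup : ∀ a b → (1 + a * 2) + (1 + b * 2) ≡ (a + b + 1) * 2
    regroup = solve-∀
    a+b+1≋ : toℕ a + toℕ b + 1 ℤM.≋ toℕ (a ⊕ b ⊕ 1ₘ)
    a+b+1≋ = ℤM.≋-sym (ℤM.≋-trans (ℤM.toℕ-⊕ (a ⊕ b) 1ₘ)
                                   (ℤM.+-cong (ℤM.toℕ-⊕ a b) (ℤM.toℕ-[]-≋ 1)))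

  interleave : (Fin M → Bool) → (Fin M → Bool) → Fin N → Bool
  interleave ψ₀ ψ₁ x = [ ψ₀ ∘ proj₁ , ψ₁ ∘ proj₁ ]′ (ι-split x)

  private
    ι₁-⊕-ι₀ : ∀ a b → ι₁ a ⊕ ι₀ b ≡ ι₁ (b ⊕ a)
    ι₁-⊕-ι₀ a b = trans (ℤN.⊕-comm (ι₁ a) (ι₀ b)) (ι₀-⊕-ι₁ b a)

  interleave-avoids-ι₀ : ∀ {ψ₀ ψ₁ u u′} → Avoids _⊕_ ψ₀ u → Avoids _⊕_ ψ₁ u′ → u′ ⊕ 1ₘ ≡ u →
                         Avoids _⊕_ (interleave ψ₀ ψ₁) (ι₀ u)
  interleave-avoids-ι₀ {ψ₀} {ψ₁} {u} {u′} avoids₀ avoids₁ u′⊕1≡u x y x≢y sum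
    with ι-split x | ι-split y
  ... | inj₁ (a , refl) | inj₁ (b , refl) =
    avoids₀ a b (x≢y ∘ cong ι₀) (ι₀-injective (trans (sym (ι₀-⊕-ι₀ a b)) sum))
  ... | inj₁ (a , refl) | inj₂ (b , refl) = ⊥-elim (ι₀≢ι₁ (trans (sym sum) (ι₀-⊕-ι₁ a b)))
  ... | inj₂ (a , refl) | inj₁ (b , refl) = ⊥-elim (ι₀≢ι₁ (trans (sym sum) (ι₁-⊕-ι₀ a b)))
  ... | inj₂ (a , refl) | inj₂ (b , refl) =
    avoids₁ a b (x≢y ∘ cong ι₁)
        (∙-cancelʳ 1ₘ (a ⊕ b) u′ (trans (ι₀-injective (trans (sym (ι₁-⊕-ι₁ a b)) sum)) (sym u′⊕1≡u)))
    where open import Algebra.Properties.AbelianGroup ℤM.abelianGroup using (∙-cancelʳ)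

  interleave-avoids-ι₁ : ∀ {ψ₀ ψ₁ c} → (∀ a b → a ⊕ b ≡ c → ψ₀ a ≢ ψ₁ b) →
                         Avoids _⊕_ (interleave ψ₀ ψ₁) (ι₁ c)
  interleave-avoids-ι₁ {ψ₀} {ψ₁} separated x y x≢y sum with ι-split x | ι-split y
  ... | inj₁ (a , refl) | inj₁ (b , refl) = ⊥-elim (ι₀≢ι₁ (trans (sym (ι₀-⊕-ι₀ a b)) sum))
  ... | inj₁ (a , refl) | inj₂ (b , refl) =
    separated a b (ι₁-injective (trans (sym (ι₀-⊕-ι₁ a b)) sum))
  ... | inj₂ (a , refl) | inj₁ (b , refl) =
    separated b a (ι₁-injective (trans (sym (ι₁-⊕-ι₀ a b)) sum)) ∘ sym
  ... | inj₂ (a , refl) | inj₂ (b , refl) = ⊥-elim (ι₀≢ι₁ (trans (sym (ι₁-⊕-ι₁ a b)) sum))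

  -- Two summands of an odd target have different parities, so to handle it the
  -- colouring of the odd half must be the negated reflection of the even half.
  twist : (Fin M → Bool) → Fin M → Fin N → Bool
  twist ψ c = interleave ψ (not ∘ ψ ∘ (c ℤM.-_))

  twist-avoids-ι₁ : ∀ ψ c → Avoids _⊕_ (twist ψ c) (ι₁ c)
  twist-avoids-ι₁ ψ c =
    interleave-avoids-ι₁ (λ a b a⊕b≡c → not-¬ (cong ψ (sym (ℤM.x∙y≡z⇒z-y≡x a⊕b≡c))))

  twist-avoids-ι₀ : ∀ {ψ c u w} → Avoids _⊕_ ψ u → Avoids _⊕_ ψ w → u ⊕ w ≡ c ⊕ c ⊕ 1ₘ →
                    Avoids _⊕_ (twist ψ c) (ι₀ u)
  twist-avoids-ι₀ {ψ} {c} {u} {w} avoids-u avoids-w u⊕w≡ =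
    interleave-avoids-ι₀ avoids-u (avoids-not _⊕_ (ℤM.avoids-reflect avoids-w reflected)) (ℤM.[x-y]∙y≡x u 1ₘ)
    where
    reflected : (u ℤM.- 1ₘ) ⊕ w ≡ c ⊕ c
    reflected = trans (ℤM.[x-y]∙z≡[x∙z]-y u 1ₘ w)
                      (trans (cong (ℤM._- 1ₘ) u⊕w≡) (ℤM.x∙y≡z⇒z-y≡x refl))

  parity : Fin N → Bool
  parity = interleave (λ _ → true) (λ _ → false)

  parity-avoids-ι₁ : ∀ c → Avoids _⊕_ parity (ι₁ c)
  parity-avoids-ι₁ c = interleave-avoids-ι₁ (λ _ _ _ ())

  ι₀-even : ∀ y → Even (ι₀ y)
  ι₀-even y = [ toℕ y ]ₙ , ℤN.⊕-≡ [ toℕ y ]ₙ [ toℕ y ]ₙ (ℤN.≋-reflexive (begin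
      toℕ [ toℕ y ]ₙ + toℕ [ toℕ y ]ₙ    ≡⟨ cong (λ n → n + n) toℕ-lift ⟩
      toℕ y + toℕ y                      ≡⟨ double (toℕ y) ⟩
      toℕ y * 2                          ≡⟨ toℕ-ι₀ y ⟨
      toℕ (ι₀ y)                         ∎))
    where
    open ≡-Reasoning
    toℕ-lift : toℕ ([_]ₙ {N} (toℕ y)) ≡ toℕ y
    toℕ-lift = trans (ℤN.toℕ-[] (toℕ y))
                     (m<n⇒m%n≡m (<-≤-trans (toℕ<n y) (subst (M ≤_) (sym N≡M+M) (m≤m+n M M))))
    double : ∀ m → m + m ≡ m * 2
    double = solve-∀

  even⇒ι₀ : ∀ {x} → Even x → ∃ λ y → x ≡ ι₀ y
  even⇒ι₀ (z , refl) with ι-split z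
  ... | inj₁ (a , refl) = a ⊕ a , ι₀-⊕-ι₀ a a
  ... | inj₂ (a , refl) = a ⊕ a ⊕ 1ₘ , ι₁-⊕-ι₁ a a

  ι₁-odd : ∀ y → Odd (ι₁ y)
  ι₁-odd y ι₁y-even = ι₀≢ι₁ (sym (proj₂ (even⇒ι₀ ι₁y-even)))

  odd⇒ι₁ : ∀ {x} → Odd x → ∃ λ y → x ≡ ι₁ y
  odd⇒ι₁ {x} x-odd with ι-split x
  ... | inj₁ (y , refl) = ⊥-elim (x-odd (ι₀-even y))
  ... | inj₂ x≡ι₁y      = x≡ι₁y

  even-or-odd : ∀ x → Even x ⊎ Odd x
  even-or-odd x with ι-split x
  ... | inj₁ (y , refl) = inj₁ (ι₀-even y)
  ... | inj₂ (y , refl) = inj₂ (ι₁-odd y)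

  odd-⊕-odd : ∀ {a b} → Odd a → Odd b → Even (a ⊕ b)
  odd-⊕-odd a-odd b-odd with odd⇒ι₁ a-odd | odd⇒ι₁ b-odd
  ... | a′ , refl | b′ , refl = subst Even (sym (ι₁-⊕-ι₁ a′ b′)) (ι₀-even _)

  even-⊕-odd : ∀ {a b} → Even a → Odd b → Odd (a ⊕ b)
  even-⊕-odd a-even b-odd with even⇒ι₀ a-even | odd⇒ι₁ b-odd
  ... | a′ , refl | b′ , refl = subst Odd (sym (ι₀-⊕-ι₁ a′ b′)) (ι₁-odd _)

  module _ (avoids-pairs : ∀ (u v : Fin M) → ∃ λ ψ → Avoids _⊕_ ψ u × Avoids _⊕_ ψ v) where

    private
      twisted : ∀ a c → ∃ λ χ → Avoids _⊕_ χ (ι₀ a) × Avoids _⊕_ χ (ι₁ c)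
      twisted a c =
        twist ψ c , twist-avoids-ι₀ ψa ψw (trans (ℤM.⊕-comm a w) (ℤM.[x-y]∙y≡x _ a)) , twist-avoids-ι₁ ψ c
        where
        w = (c ⊕ c ⊕ 1ₘ) ℤM.- a
        ψ = proj₁ (avoids-pairs a w)
        ψa = proj₁ (proj₂ (avoids-pairs a w))
        ψw = proj₂ (proj₂ (avoids-pairs a w))

    avoids-pair : ∀ (u v : Fin N) → ∃ λ χ → Avoids _⊕_ χ u × Avoids _⊕_ χ v
    avoids-pair u v with ι-split u | ι-split v
    ... | inj₁ (a , refl) | inj₁ (b , refl) =
      let (ψ₀ , ψ₀a , ψ₀b) = avoids-pairs a b
          (ψ₁ , ψ₁a , ψ₁b) = avoids-pairs (a ℤM.- 1ₘ) (b ℤM.- 1ₘ)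
      in interleave ψ₀ ψ₁ , interleave-avoids-ι₀ ψ₀a ψ₁a (ℤM.[x-y]∙y≡x a 1ₘ)
                          , interleave-avoids-ι₀ ψ₀b ψ₁b (ℤM.[x-y]∙y≡x b 1ₘ)
    ... | inj₁ (a , refl) | inj₂ (c , refl) = twisted a c
    ... | inj₂ (c , refl) | inj₁ (a , refl) = let (χ , χa , χc) = twisted a c in χ , χc , χa
    ... | inj₂ (c , refl) | inj₂ (d , refl) = parity , parity-avoids-ι₁ c , parity-avoids-ι₁ d

PairsAvoidable : ℕ → Set
PairsAvoidable N = ∀ {{_ : NonZero N}} (u v : Fin N) → ∃ λ χ → Avoids _⊕_ χ u × Avoids _⊕_ χ v

pairs-avoidable : ∀ N → PairsAvoidable N
pairs-avoidable = <-rec PairsAvoidable step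
  where
  step : ∀ N → (∀ {M} → M < N → PairsAvoidable M) → PairsAvoidable N
  step N rec u v with %2-cases N
  ... | inj₂ N-odd  = OddModulus.avoids-pair N-odd u v
  ... | inj₁ N-even = Halving.avoids-pair N≡M+M (rec (m/n<m N 2 (s≤s (s≤s z≤n)))) u v
    where
    N≡M+M : N ≡ N / 2 + N / 2
    N≡M+M = even⇒≡double N-even
    instance
      M≢0 : NonZero (N / 2)
      M≢0 = ≢-nonZero (λ M≡0 → ≢-nonZero⁻¹ N (trans N≡M+M (cong (λ m → m + m) M≡0)))

module _ {N M : ℕ} {{_ : NonZero N}} {{_ : NonZero M}} (N≡M+M : N ≡ M + M) where

  open Halving N≡M+M
  private
    module ℤM = ZMod M
  open import Algebra.Solver.CommutativeMonoid (AbelianGroup.commutativeMonoid ℤM.abelianGroup)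
    using (solve; _⊜_) renaming (_⊕_ to _⊞_)

  avoids-triple : ∀ {a x : Fin N} → Even a → Odd x →
                     ∃ λ χ → Avoids _⊕_ χ a × Avoids _⊕_ χ (a ⊕ x) × Avoids _⊕_ χ (a ⊕ x ⊕ x)
  avoids-triple a-even x-odd with even⇒ι₀ a-even | odd⇒ι₁ x-odd
  ... | a′ , refl | x′ , refl =
    twist ψ c ,
    twist-avoids-ι₀ ψa′ ψw a′⊕w≡ ,
    subst (Avoids _⊕_ (twist ψ c)) (sym (ι₀-⊕-ι₁ a′ x′)) (twist-avoids-ι₁ ψ c) ,
    subst (Avoids _⊕_ (twist ψ c)) (sym (trans (cong (_⊕ ι₁ x′) (ι₀-⊕-ι₁ a′ x′)) (ι₁-⊕-ι₁ c x′)))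
      (twist-avoids-ι₀ ψw ψa′ (trans (ℤM.⊕-comm w a′) a′⊕w≡))
    where
    c = a′ ⊕ x′
    w = c ⊕ x′ ⊕ 1ₘ
    ψ = proj₁ (pairs-avoidable M a′ w)
    ψa′ = proj₁ (proj₂ (pairs-avoidable M a′ w))
    ψw = proj₂ (proj₂ (pairs-avoidable M a′ w))
    a′⊕w≡ : a′ ⊕ w ≡ c ⊕ c ⊕ 1ₘ
    a′⊕w≡ = solve 3 (λ p q r → p ⊞ (((p ⊞ q) ⊞ q) ⊞ r) ⊜ ((p ⊞ q) ⊞ (p ⊞ q)) ⊞ r) refl a′ x′ 1ₘ

avoidable-Pair : ∀ {N} {{_ : NonZero N}} {a b : Fin N} → a ≢ b → AvoidableByColouring _⊕_ (Pair a b)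
avoidable-Pair {N} {a} {b} a≢b = χ , nonconstant (a ≟ 0ₙ) , λ { _ (inj₁ refl) → χa ; _ (inj₂ refl) → χb }
  where
  open ZMod N
  χ = proj₁ (pairs-avoidable N a b)
  χa = proj₁ (proj₂ (pairs-avoidable N a b))
  χb = proj₂ (proj₂ (pairs-avoidable N a b))
  nonconstant : Dec (a ≡ 0ₙ) → NonConstant _⊕_ χ
  nonconstant (yes a≡0) = nonConstant _⊕_ 0ₙ b (avoids⇒χε≢χ χb (a≢b ∘ trans a≡0 ∘ sym))
  nonconstant (no a≢0)  = nonConstant _⊕_ 0ₙ a (avoids⇒χε≢χ χa a≢0)

-- Even moduli: maximality

odd≢even : ∀ {N} {{_ : NonZero N}} {a b : Fin N} → Odd a → Even b → a ≢ b
odd≢even a-odd b-even refl = a-odd b-even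

module EvenModulus {N M : ℕ} {{_ : NonZero N}} {{_ : NonZero M}} (N≡M+M : N ≡ M + M) where

  open ZMod N
  open Halving N≡M+M
  open import Algebra.Properties.AbelianGroup abelianGroup
    using (x∙y⁻¹≈ε⇒x≈y; ⁻¹-involutive; ∙-cancelˡ; ∙-cancelʳ)

  private
    variable
      χ : Fin N → Bool

  even? : ∀ z → Dec (Even z)
  even? z = [ yes , no ]′ (even-or-odd z)

  odd-⊕-even : ∀ {a b} → Odd a → Even b → Odd (a ⊕ b)
  odd-⊕-even {a} {b} a-odd b-even = subst Odd (⊕-comm b a) (even-⊕-odd b-even a-odd)

  half : Fin N
  half = [ N / 2 ]ₙ

  N/2≡M : N / 2 ≡ M
  N/2≡M = trans (cong (_/ 2) (trans N≡M+M (double M))) (m*n/n≡m M 2)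
    where
    double : ∀ m → m + m ≡ m * 2
    double = solve-∀

  toℕ-half : toℕ half ≡ M
  toℕ-half = trans (toℕ-[] (N / 2)) (trans (cong (_% N) N/2≡M) (m<n⇒m%n≡m M<N))
    where
    M<N : M < N
    M<N = subst (M <_) (sym N≡M+M) (m<m+n M (>-nonZero⁻¹ M))

  private
    halves-equal : ∀ {m n} → m + m ≡ n + n → m ≡ n
    halves-equal {m} {n} eq = *-cancelʳ-≡ m n 2 (trans (sym (double m)) (trans eq (double n)))
      where
      double : ∀ m → m + m ≡ m * 2
      double = solve-∀

  doubles-equal : ∀ {x y} → x ⊕ x ≡ y ⊕ y → x ≡ y ⊎ x ≡ y ⊕ half
  doubles-equal {x} {y} xx≡yy =
    [ inj₁ ∘ no-overflow , inj₂ ∘ overflow ]′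
      (+-≋-cases (toℕ<n (x - y)) (toℕ<n (x - y)) (>-nonZero⁻¹ N) dd≋0)
    where
    dd≋0 : toℕ (x - y) + toℕ (x - y) ≋ 0
    dd≋0 = ≋-trans (≋-sym (toℕ-⊕ (x - y) (x - y)))
                   (≋-reflexive (trans (cong toℕ (x∙x≡y∙y⇒[x-y]∙[x-y]≡ε {x} {y} xx≡yy)) toℕ-0ₙ))
    no-overflow : toℕ (x - y) + toℕ (x - y) ≡ 0 → x ≡ y
    no-overflow dd≡0 = x∙y⁻¹≈ε⇒x≈y x y (toℕ-injective (trans (m+n≡0⇒m≡0 _ dd≡0) (sym toℕ-0ₙ)))
    overflow : toℕ (x - y) + toℕ (x - y) ≡ 0 + N → x ≡ y ⊕ half
    overflow dd≡N = begin
      x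
        ≡⟨ [x-y]∙y≡x x y ⟨
      (x - y) ⊕ y
        ≡⟨ cong (_⊕ y) (toℕ-injective (trans (halves-equal (trans dd≡N N≡M+M)) (sym toℕ-half))) ⟩
      half ⊕ y
        ≡⟨ ⊕-comm half y ⟩
      y ⊕ half ∎
      where open ≡-Reasoning

  half⊕half≡0 : half ⊕ half ≡ 0ₙ
  half⊕half≡0 = ⊕-≡ half half (≋-trans (≋-reflexive (trans (cong₂ _+_ toℕ-half toℕ-half) (sym N≡M+M)))
                                (≋-trans N≋0 (≋-reflexive (sym toℕ-0ₙ))))

  shifted-double : ∀ a → (a ⊕ half) ⊕ (a ⊕ half) ≡ a ⊕ a
  shifted-double a = trans (∙-double a half) (trans (cong ((a ⊕ a) ⊕_) half⊕half≡0) (⊕-identityʳ (a ⊕ a)))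

  three-evens : ∀ {u z w} → Avoids _⊕_ χ u → Avoids _⊕_ χ z → Avoids _⊕_ χ w →
                Even u → Even z → Even w →
                u ≢ z → z ≢ w → u ≢ w → ⊥
  three-evens {u = u} {z} {w} χu χz χw u-even z-even w-even u≢z z≢w u≢w = triangle χu χz χw u≢z z≢w u≢w
    (double⇒midpoint u w z (double-∙ (double-∙ u-even w-even) (double-⁻¹ z-even)))

  two-odds : ∀ {o₁ z o₂} → Avoids _⊕_ χ o₁ → Avoids _⊕_ χ z → Avoids _⊕_ χ o₂ →
             Odd o₁ → Even z → Odd o₂ →
             o₁ ≢ o₂ → ⊥
  two-odds {o₁ = o₁} {z} {o₂} χo₁ χz χo₂ o₁-odd z-even o₂-odd o₁≢o₂ =
    triangle χo₁ χz χo₂ (odd≢even o₁-odd z-even) (odd≢even o₂-odd z-even ∘ sym) o₁≢o₂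
      (double⇒midpoint o₁ o₂ z (double-∙ (odd-⊕-odd o₁-odd o₂-odd) (double-⁻¹ z-even)))

  even-pair-odd-midpoint : ∀ {e₁ e₂ o} → Avoids _⊕_ χ e₁ → Avoids _⊕_ χ e₂ → Avoids _⊕_ χ o →
                           Even e₁ → Even e₂ → Odd o → e₁ ≢ e₂ → e₁ ⊕ e₂ ≡ o ⊕ o
  even-pair-odd-midpoint {e₁ = e₁} {e₂} {o} χe₁ χe₂ χo e₁-even e₂-even o-odd e₁≢e₂
    with e₁ ⊕ e₂ ≟ o ⊕ o | e₁ ⊕ e₁ ≟ o ⊕ o | e₂ ⊕ e₂ ≟ o ⊕ o
  ... | yes e₁e₂≡oo | _ | _ = e₁e₂≡oo
  ... | no e₁e₂≢oo | no e₁e₁≢oo | _ =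
    ⊥-elim (pentagon χe₁ χe₂ χo e₁≢e₂ (odd≢even o-odd e₂-even ∘ sym) e₁e₂≢oo e₁e₁≢oo
              (odd≢even (odd-⊕-even o-odd e₂-even) (e₁ , refl) ∘ trans (⊕-comm o e₂))
              (double⇒midpoint o o e₂ (double-∙ (o , refl) (double-⁻¹ e₂-even))))
  ... | no e₁e₂≢oo | yes _ | no e₂e₂≢oo =
    ⊥-elim (pentagon χe₂ χe₁ χo (e₁≢e₂ ∘ sym) (odd≢even o-odd e₁-even ∘ sym)
              (e₁e₂≢oo ∘ trans (⊕-comm e₁ e₂)) e₂e₂≢oo
              (odd≢even (odd-⊕-even o-odd e₁-even) (e₂ , refl) ∘ trans (⊕-comm o e₁))
              (double⇒midpoint o o e₁ (double-∙ (o , refl) (double-⁻¹ e₁-even))))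
  ... | no _ | yes e₁e₁≡oo | yes e₂e₂≡oo =
    ⊥-elim (e₁≢e₂ (trans (opposite e₁-even e₁e₁≡oo) (sym (opposite e₂-even e₂e₂≡oo))))
    where
    opposite : ∀ {e} → Even e → e ⊕ e ≡ o ⊕ o → e ≡ o ⊕ half
    opposite e-even ee≡oo = [ ⊥-elim ∘ odd≢even o-odd e-even ∘ sym , id ]′ (doubles-equal ee≡oo)

  ι₁-[] : ∀ l → ι₁ [ l ]ₙ ≡ [ 2 * l + 1 ]ₙ
  ι₁-[] l = toℕ-≋-injective (begin
      toℕ (ι₁ [ l ]ₙ)              ≡⟨ toℕ-ι₁ [ l ]ₙ ⟩
      1 + toℕ ([_]ₙ {M} l) * 2     ≈⟨ +-cong (≋-refl {1}) (≋-*-congʳ M*2≡N (ZMod.toℕ-[]-≋ M l)) ⟩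
      1 + l * 2                    ≡⟨ reorder l ⟩
      2 * l + 1                    ≈⟨ toℕ-[]-≋ (2 * l + 1) ⟨
      toℕ [ 2 * l + 1 ]ₙ           ∎)
    where
    open ≋-Reasoning
    reorder : ∀ l → 1 + l * 2 ≡ 2 * l + 1
    reorder = solve-∀
    M*2≡N : M * 2 ≡ N
    M*2≡N = trans (double M) (sym N≡M+M)
      where
      double : ∀ m → m * 2 ≡ m + m
      double = solve-∀

  private
    positive-representative : ∀ (y : Fin M) → ∃ λ l → 1 ≤ l × l ≤ M × y ≡ [ l ]ₙ
    positive-representative y with toℕ y in eq
    ... | zero  = M , >-nonZero⁻¹ M , ≤-refl , toℕ-injective (trans eq (sym (trans (ZMod.toℕ-[] M M) (n%n≡0 M))))
    ... | suc t = suc t , s≤s z≤n , subst (_≤ M) eq (<⇒≤ (toℕ<n y)) ,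
                  toℕ-injective (trans eq (sym (trans (ZMod.toℕ-[] M (suc t))
                                                      (m<n⇒m%n≡m (subst (_< M) eq (toℕ<n y))))))

  odd⇔oddSet : ∀ z → Odd z ⇔ OddSet z
  odd⇔oddSet z = mk⇔ to from
    where
    to : Odd z → OddSet z
    to z-odd with odd⇒ι₁ z-odd
    ... | y , refl with positive-representative y
    ...   | l , 1≤l , l≤M , refl = l , 1≤l , subst (l ≤_) (sym N/2≡M) l≤M , ι₁-[] l
    from : OddSet z → Odd z
    from (l , _ , _ , refl) = subst Odd (ι₁-[] l) (ι₁-odd [ l ]ₙ)

  oddSet? : ∀ z → Dec (OddSet z)
  oddSet? z = Relation.Nullary.Decidable.map (odd⇔oddSet z) (¬? (even? z))

  one : Fin N
  one = [ 1 ]ₙ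

  one-odd : Odd one
  one-odd = subst Odd (ι₁-[] 0) (ι₁-odd [ 0 ]ₙ)

  odd⇒≢0 : ∀ {x} → Odd x → x ≢ 0ₙ
  odd⇒≢0 x-odd = odd≢even x-odd (0ₙ , ⊕-identityˡ 0ₙ)

  odd-⊖ : ∀ {a} → Odd a → Odd (⊖ a)
  odd-⊖ {a} a-odd ⊖a-even = a-odd (subst Even (⁻¹-involutive a) (double-⁻¹ ⊖a-even))

  parity-avoids-odd : ∀ {z} → Odd z → Avoids _⊕_ parity z
  parity-avoids-odd z-odd with odd⇒ι₁ z-odd
  ... | c , refl = parity-avoids-ι₁ c

  avoidable-OddSet : AvoidableByColouring _⊕_ OddSet
  avoidable-OddSet =
    parity ,
    nonConstant _⊕_ 0ₙ one (avoids⇒χε≢χ (parity-avoids-odd one-odd) (odd⇒≢0 one-odd)) ,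
    λ z → parity-avoids-odd ∘ Equivalence.from (odd⇔oddSet z)

  maximal-OddSet : N ≢ 2 → Maximal _⊕_ OddSet
  maximal-OddSet N≢2 χ χ-avoids z χz with even-or-odd z
  ... | inj₂ z-odd  = Equivalence.to (odd⇔oddSet z) z-odd
  ... | inj₁ z-even =
    ⊥-elim (two-odds (avoids-odd one-odd) χz (avoids-odd ⊖one-odd) one-odd z-even ⊖one-odd one≢⊖one)
    where
    avoids-odd : ∀ {o} → Odd o → Avoids _⊕_ χ o
    avoids-odd {o} o-odd = χ-avoids o (Equivalence.to (odd⇔oddSet o) o-odd)
    ⊖one-odd = odd-⊖ one-odd
    one≢⊖one : one ≢ ⊖ one
    one≢⊖one one≡⊖one = N≢2 (≤-antisym (∣⇒≤ (≋0⇒∣ 2≋0)) 2≤N)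
      where
      2≋0 : 2 ≋ 0
      2≋0 = ≋-trans (+-cong (≋-sym (toℕ-[]-≋ 1)) (≋-sym (toℕ-[]-≋ 1)))
              (≋-trans (≋-sym (toℕ-⊕ one one))
                (≋-reflexive (trans (cong toℕ (trans (cong (one ⊕_) one≡⊖one) (⊖-inverseʳ one))) toℕ-0ₙ)))
      2≤N : 2 ≤ N
      2≤N = subst (2 ≤_) (sym N≡M+M) (+-mono-≤ (>-nonZero⁻¹ M) (>-nonZero⁻¹ M))

  avoidable-Triple : ∀ {a x} → Even a → Odd x → AvoidableByColouring _⊕_ (Triple a x)
  avoidable-Triple a-even x-odd with avoids-triple N≡M+M a-even x-odd
  ... | χ , χa , χax , χaxx =
    χ , nonConstant _⊕_ 0ₙ _ (avoids⇒χε≢χ χax (odd⇒≢0 (even-⊕-odd a-even x-odd))) , λ where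
    _ (inj₁ refl)        → χa
    _ (inj₂ (inj₁ refl)) → χax
    _ (inj₂ (inj₂ refl)) → χaxx

  maximal-Triple : ∀ {a x} → Even a → Odd x → a ≢ a ⊕ x ⊕ x → Maximal _⊕_ (Triple a x)
  maximal-Triple {a} {x} a-even x-odd a≢a+2x χ χ-avoids z χz =
    decidable-stable (triple? a x z) (λ z∉T → [ even-case z∉T , odd-case z∉T ]′ (even-or-odd z))
    where
    a+x-odd = even-⊕-odd a-even x-odd
    even-case : ¬ Triple a x z → Even z → ⊥
    even-case z∉T z-even = three-evens (χ-avoids a (inj₁ refl)) χz (χ-avoids (a ⊕ x ⊕ x) (inj₂ (inj₂ refl)))
      a-even z-even (odd-⊕-odd a+x-odd x-odd) (z∉T ∘ inj₁ ∘ sym) (z∉T ∘ inj₂ ∘ inj₂) a≢a+2x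
    odd-case : ¬ Triple a x z → Odd z → ⊥
    odd-case z∉T z-odd = two-odds χz (χ-avoids a (inj₁ refl)) (χ-avoids (a ⊕ x) (inj₂ (inj₁ refl)))
      z-odd a-even a+x-odd (z∉T ∘ inj₂ ∘ inj₁)

  private
    opposite-pair-maximal : ∀ {e o z} → Avoids _⊕_ χ e → Avoids _⊕_ χ o → Avoids _⊕_ χ z →
                            Even e → Odd o →
                            o ⊕ o ≡ e ⊕ e → z ≢ e → z ≢ o → ⊥
    opposite-pair-maximal {e = e} {o} {z} χe χo χz e-even o-odd oo≡ee z≢e z≢o with even-or-odd z
    ... | inj₁ z-even =
      z≢e (∙-cancelʳ e z e (trans (even-pair-odd-midpoint χz χe χo z-even e-even o-odd z≢e) oo≡ee))
    ... | inj₂ z-odd  = two-odds χz χe χo z-odd e-even o-odd z≢o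

  maximal-half-Pair : Odd half → ∀ a → Maximal _⊕_ (Pair a (a ⊕ half))
  maximal-half-Pair half-odd a χ χ-avoids z χz =
    decidable-stable (pair? a (a ⊕ half) z) (λ z∉P → [ a-even-case z∉P , a-odd-case z∉P ]′ (even-or-odd a))
    where
    χa = χ-avoids a (inj₁ refl)
    χa+half = χ-avoids (a ⊕ half) (inj₂ refl)
    a-even-case : ¬ Pair a (a ⊕ half) z → Even a → ⊥
    a-even-case z∉P a-even = opposite-pair-maximal χa χa+half χz a-even (even-⊕-odd a-even half-odd)
      (shifted-double a) (z∉P ∘ inj₁) (z∉P ∘ inj₂)
    a-odd-case : ¬ Pair a (a ⊕ half) z → Odd a → ⊥
    a-odd-case z∉P a-odd = opposite-pair-maximal χa+half χa χz (odd-⊕-odd a-odd half-odd) a-odd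
      (sym (shifted-double a)) (z∉P ∘ inj₂) (z∉P ∘ inj₁)

  maximal-quadruple-Pair : Even half → ∀ {a} x → Even a → a ≢ a ⊕ (x ⊕ x ⊕ x ⊕ x) →
                           Maximal _⊕_ (Pair a (a ⊕ (x ⊕ x ⊕ x ⊕ x)))
  maximal-quadruple-Pair half-even {a} x a-even a≢b χ χ-avoids z χz =
    decidable-stable (pair? a b z) (λ z∉P → [ even-case z∉P , odd-case z∉P ]′ (even-or-odd z))
    where
    b = a ⊕ (x ⊕ x ⊕ x ⊕ x)
    c = a ⊕ (x ⊕ x)
    χa = χ-avoids a (inj₁ refl)
    χb = χ-avoids b (inj₂ refl)
    b-even : Even b
    b-even = double-∙ a-even (x ⊕ x , sym (⊕-assoc (x ⊕ x) x x))
    c-even : Even c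
    c-even = double-∙ a-even (x , refl)
    a⊕b≡c⊕c : a ⊕ b ≡ c ⊕ c
    a⊕b≡c⊕c = begin
      a ⊕ (a ⊕ (x ⊕ x ⊕ x ⊕ x))          ≡⟨ ⊕-assoc a a _ ⟨
      (a ⊕ a) ⊕ (x ⊕ x ⊕ x ⊕ x)          ≡⟨ cong ((a ⊕ a) ⊕_) (⊕-assoc (x ⊕ x) x x) ⟩
      (a ⊕ a) ⊕ ((x ⊕ x) ⊕ (x ⊕ x))      ≡⟨ ∙-double a (x ⊕ x) ⟨
      c ⊕ c                              ∎
      where open ≡-Reasoning
    even-case : ¬ Pair a b z → Even z → ⊥
    even-case z∉P z-even =
      three-evens χa χz χb a-even z-even b-even (z∉P ∘ inj₁ ∘ sym) (z∉P ∘ inj₂) a≢b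
    odd-case : ¬ Pair a b z → Odd z → ⊥
    odd-case z∉P z-odd =
      [ odd≢even z-odd c-even , odd≢even z-odd (double-∙ c-even half-even) ]′
        (doubles-equal (trans (sym (even-pair-odd-midpoint χa χb χz a-even b-even z-odd a≢b)) a⊕b≡c⊕c))

  -- A triple a, a + x, a + 2x with a even and x odd covers every avoidable set
  -- with at most one odd element.
  data Shape (U : Subset N) : Set where
    odd-only     : (∀ z → z ∈ U → Odd z) → Shape U
    in-triple    : ∀ {e x} → Even e → Odd x → (∀ z → z ∈ U → Triple e x z) → Shape U
    in-even-pair : ∀ {e₁ e₂} → Even e₁ → Even e₂ → e₁ ≢ e₂ →
                   (∀ z → z ∈ U → Pair e₁ e₂ z) → Shape U

  module _ {χ : Fin N → Bool} {U : Subset N} (χ-avoids : ∀ u → u ∈ U → Avoids _⊕_ χ u) where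

    private
      by-parity : ∀ {S : Fin N → Set} →
                  (∀ z → z ∈ U → Even z → S z) → (∀ z → z ∈ U → Odd z → S z) →
                  ∀ z → z ∈ U → S z
      by-parity evens odds z z∈U = [ evens z z∈U , odds z z∈U ]′ (even-or-odd z)

      no-evens : ∀ {S : Fin N → Set} → (∀ z → ¬ (z ∈ U × Even z)) → ∀ z → z ∈ U → Even z → S z
      no-evens ∄ z z∈U z-even = ⊥-elim (∄ z (z∈U , z-even))

      no-odds : ∀ {S : Fin N → Set} → (∀ z → ¬ (z ∈ U × Odd z)) → ∀ z → z ∈ U → Odd z → S z
      no-odds ∄ z z∈U z-odd = ⊥-elim (∄ z (z∈U , z-odd))

      only-two-evens : ∀ {e₁ e₂} → e₁ ∈ U × Even e₁ → e₂ ∈ U × Even e₂ → e₁ ≢ e₂ →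
                       ∀ z → z ∈ U → Even z → z ≡ e₁ ⊎ z ≡ e₂
      only-two-evens {e₁} {e₂} (e₁∈U , e₁-even) (e₂∈U , e₂-even) e₁≢e₂ z z∈U z-even =
        decidable-stable (pair? e₁ e₂ z) λ z∉P →
          three-evens (χ-avoids e₁ e₁∈U) (χ-avoids z z∈U) (χ-avoids e₂ e₂∈U) e₁-even z-even e₂-even
                      (z∉P ∘ inj₁ ∘ sym) (z∉P ∘ inj₂) e₁≢e₂

    avoided-shape : Shape U
    avoided-shape with witnesses (λ z → (z ∈? U) ×-dec ¬? (even? z)) | witnesses (λ z → (z ∈? U) ×-dec even? z)
    ... | two o₁ o₂ (o₁∈U , o₁-odd) (o₂∈U , o₂-odd) o₁≢o₂ | _ =
      odd-only (by-parity (λ z z∈U z-even → ⊥-elim (two-odds (χ-avoids o₁ o₁∈U) (χ-avoids z z∈U)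
                                                            (χ-avoids o₂ o₂∈U) o₁-odd z-even o₂-odd o₁≢o₂))
                          (λ _ _ z-odd → z-odd))
    ... | unique o (o∈U , o-odd) odd-is-o
        | two e₁ e₂ e₁∈Uₑ@(e₁∈U , e₁-even) e₂∈Uₑ@(e₂∈U , e₂-even) e₁≢e₂ =
      in-triple e₁-even (odd-⊕-even o-odd (double-⁻¹ e₁-even))
        (by-parity (λ z z∈U z-even → map id (inj₂ ∘ λ z≡e₂ → trans z≡e₂ (sym e₁+2x≡e₂))
                                       (only-two-evens e₁∈Uₑ e₂∈Uₑ e₁≢e₂ z z∈U z-even))
                   (λ z z∈U z-odd → inj₂ (inj₁ (trans (odd-is-o z (z∈U , z-odd)) (sym (x∙[y-x]≡y e₁ o))))))
      where
      e₁+2x≡e₂ : e₁ ⊕ (o - e₁) ⊕ (o - e₁) ≡ e₂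
      e₁+2x≡e₂ = begin
        e₁ ⊕ (o - e₁) ⊕ (o - e₁)    ≡⟨ cong (_⊕ (o - e₁)) (x∙[y-x]≡y e₁ o) ⟩
        o ⊕ (o - e₁)                ≡⟨ ⊕-comm o (o - e₁) ⟩
        (o - e₁) ⊕ o                ≡⟨ [x-y]∙z≡[x∙z]-y o e₁ o ⟩
        (o ⊕ o) - e₁                ≡⟨ cong (_- e₁) (trans (sym midpoint) (⊕-comm e₁ e₂)) ⟩
        (e₂ ⊕ e₁) - e₁              ≡⟨ x∙y≡z⇒z-y≡x refl ⟩
        e₂                          ∎
        where
        open ≡-Reasoning
        midpoint = even-pair-odd-midpoint (χ-avoids e₁ e₁∈U) (χ-avoids e₂ e₂∈U) (χ-avoids o o∈U)
                                          e₁-even e₂-even o-odd e₁≢e₂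
    ... | unique o (o∈U , o-odd) odd-is-o | unique e (e∈U , e-even) even-is-e =
      in-triple e-even (odd-⊕-even o-odd (double-⁻¹ e-even))
        (by-parity (λ z z∈U z-even → inj₁ (even-is-e z (z∈U , z-even)))
                   (λ z z∈U z-odd → inj₂ (inj₁ (trans (odd-is-o z (z∈U , z-odd)) (sym (x∙[y-x]≡y e o))))))
    ... | unique o (o∈U , o-odd) odd-is-o | none ∄even =
      in-triple (odd-⊕-odd o-odd (odd-⊖ one-odd)) one-odd
        (by-parity (no-evens ∄even)
                   (λ z z∈U z-odd → inj₂ (inj₁ (trans (odd-is-o z (z∈U , z-odd)) (sym ([x-y]∙y≡x o one))))))
    ... | none ∄odd | two e₁ e₂ e₁∈Uₑ@(_ , e₁-even) e₂∈Uₑ@(_ , e₂-even) e₁≢e₂ =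
      in-even-pair e₁-even e₂-even e₁≢e₂ (by-parity (only-two-evens e₁∈Uₑ e₂∈Uₑ e₁≢e₂) (no-odds ∄odd))
    ... | none ∄odd | unique e (_ , e-even) even-is-e =
      in-triple e-even one-odd (by-parity (λ z z∈U z-even → inj₁ (even-is-e z (z∈U , z-even))) (no-odds ∄odd))
    ... | none ∄odd | none ∄even =
      in-triple (0ₙ , ⊕-identityˡ 0ₙ) one-odd (by-parity (no-evens ∄even) (no-odds ∄odd))

  odd-step-nondegenerate : ∀ {a x} → Odd x → x ≢ half → a ≢ a ⊕ x ⊕ x
  odd-step-nondegenerate {a} {x} x-odd x≢half a≡a+2x =
    [ odd⇒≢0 x-odd , x≢half ∘ flip trans (⊕-identityˡ half) ]′ (doubles-equal x⊕x≡0⊕0)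
    where
    x⊕x≡0⊕0 : x ⊕ x ≡ 0ₙ ⊕ 0ₙ
    x⊕x≡0⊕0 = ∙-cancelˡ a _ _ (begin
      a ⊕ (x ⊕ x)      ≡⟨ ⊕-assoc a x x ⟨
      a ⊕ x ⊕ x        ≡⟨ a≡a+2x ⟨
      a                ≡⟨ ⊕-identityʳ a ⟨
      a ⊕ 0ₙ           ≡⟨ cong (a ⊕_) (⊕-identityˡ 0ₙ) ⟨
      a ⊕ (0ₙ ⊕ 0ₙ)    ∎)
      where open ≡-Reasoning

  odd-root : Odd half → ∀ {d} → Even d → ∃ λ h → Odd h × h ⊕ h ≡ d
  odd-root half-odd (h , h⊕h≡d) with even-or-odd h
  ... | inj₂ h-odd  = h , h-odd , h⊕h≡d
  ... | inj₁ h-even = h ⊕ half , even-⊕-odd h-even half-odd , trans (shifted-double h) h⊕h≡d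

  private
    toℕ-[]ₘ : ∀ {j} → j < M → toℕ ([_]ₙ {M} j) ≡ j
    toℕ-[]ₘ {j} j<M = trans (ZMod.toℕ-[] M j) (m<n⇒m%n≡m j<M)

  half-odd : ∀ {j} → M ≡ 1 + j * 2 → Odd half
  half-odd {j} M≡ = subst Odd (sym half≡) (ι₁-odd [ j ]ₙ)
    where
    j<M : j < M
    j<M = subst (j <_) (sym M≡) (s≤s (m≤m*n j 2))
    half≡ : half ≡ ι₁ [ j ]ₙ
    half≡ = toℕ-injective
      (trans toℕ-half (trans M≡ (sym (trans (toℕ-ι₁ _) (cong (λ t → 1 + t * 2) (toℕ-[]ₘ j<M))))))

  half-even : ∀ {j} → M ≡ j * 2 → Even half
  half-even {j} M≡ = subst Even (sym half≡) (ι₀-even [ j ]ₙ)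
    where
    j<M : j < M
    j<M = subst (j <_) (sym M≡) (m<m*n j 2 {{j≢0}} (s≤s (s≤s z≤n)))
      where
      j≢0 : NonZero j
      j≢0 = ≢-nonZero (λ j≡0 → ≢-nonZero⁻¹ M (trans M≡ (cong (_* 2) j≡0)))
    half≡ : half ≡ ι₀ [ j ]ₙ
    half≡ = toℕ-injective (trans toℕ-half (trans M≡ (sym (trans (toℕ-ι₀ _) (cong (_* 2) (toℕ-[]ₘ j<M))))))

  odd-is-half : M ≡ 1 → ∀ {z} → Odd z → z ≡ half
  odd-is-half M≡1 {z} z-odd = begin
      z         ≡⟨ proj₂ (odd⇒ι₁ z-odd) ⟩
      ι₁ y      ≡⟨ cong ι₁ (toℕ-injective (trans (singleton y) (sym (singleton y′)))) ⟩
      ι₁ y′     ≡⟨ proj₂ (odd⇒ι₁ half-is-odd) ⟨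
      half      ∎
    where
    open ≡-Reasoning
    half-is-odd : Odd half
    half-is-odd = half-odd {0} M≡1
    y y′ : Fin M
    y = proj₁ (odd⇒ι₁ z-odd)
    y′ = proj₁ (odd⇒ι₁ half-is-odd)
    singleton : ∀ (y : Fin M) → toℕ y ≡ 0
    singleton y = n<1⇒n≡0 (subst (toℕ y <_) M≡1 (toℕ<n y))

  pair⊆triple : ∀ {e₁ e₂ h z} → h ⊕ h ≡ e₂ - e₁ → Pair e₁ e₂ z → Triple e₁ h z
  pair⊆triple _ (inj₁ z≡e₁) = inj₁ z≡e₁
  pair⊆triple {e₁} {e₂} {h} h⊕h≡d (inj₂ z≡e₂) =
    inj₂ (inj₂ (trans z≡e₂ (sym (trans (⊕-assoc e₁ h h)
                                      (trans (cong (e₁ ⊕_) h⊕h≡d) (x∙[y-x]≡y e₁ e₂))))))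

-- The classification

odd-classification : ∀ (n k : ℕ) {{_ : NonZero n}} → n ≡ 2 * k + 1 → (U : Subset n) →
                     Saturated _⊕_ U ⇔ (∃₂ λ (a b : Fin n) → a ≢ b × U ≐ Pair a b)
odd-classification n k n≡2k+1 U = mk⇔ to from
  where
  n-odd : n % 2 ≡ 1
  n-odd = trans (cong (_% 2) (trans n≡2k+1 (reorder k))) ([m+kn]%n≡m%n 1 k 2)
    where
    reorder : ∀ k → 2 * k + 1 ≡ 1 + k * 2
    reorder = solve-∀

  to : Saturated _⊕_ U → ∃₂ λ a b → a ≢ b × U ≐ Pair a b
  to sat = let (_ , nonconst , χ-avoids) = avoidable⇒colouring _⊕_ (proj₁ sat)
               (a , b , a≢b , U⊆P) = OddModulus.avoided-within-pair n-odd nonconst χ-avoids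
           in a , b , a≢b , ≐-if-saturated _⊕_ sat (pair? a b) (avoidable-Pair a≢b) U⊆P

  from : (∃₂ λ a b → a ≢ b × U ≐ Pair a b) → Saturated _⊕_ U
  from (a , b , a≢b , U≐P) = saturated-if-≐ _⊕_ U≐P (avoidable-Pair a≢b) (OddModulus.maximal-Pair n-odd a≢b)

classification-4k+2 : ∀ (n k : ℕ) {{_ : NonZero n}} → n ≡ 4 * k + 2 → (U : Subset n) →
  Saturated _⊕_ U ⇔
    ((∃₂ λ (a x : Fin n) → Odd x × x ≢ [ n / 2 ]ₙ × Even a × U ≐ Triple a x)
    ⊎ (∃ λ (a : Fin n) → U ≐ Pair a (a ⊕ [ n / 2 ]ₙ))
    ⊎ (k > 0 × U ≐ OddSet))
classification-4k+2 n k n≡4k+2 U = mk⇔ to from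
  where
  M = 1 + k * 2
  n≡M+M : n ≡ M + M
  n≡M+M = trans n≡4k+2 (regroup k)
    where
    regroup : ∀ k → 4 * k + 2 ≡ (1 + k * 2) + (1 + k * 2)
    regroup = solve-∀
  open ZMod n
  open EvenModulus n≡M+M
  open import Algebra.Properties.AbelianGroup abelianGroup using (x∙y⁻¹≈ε⇒x≈y)

  Families : Set
  Families = (∃₂ λ (a x : Fin n) → Odd x × x ≢ half × Even a × U ≐ Triple a x)
           ⊎ (∃ λ (a : Fin n) → U ≐ Pair a (a ⊕ half))
           ⊎ (k > 0 × U ≐ OddSet)

  half-is-odd : Odd half
  half-is-odd = half-odd {k} refl

  n≢2 : k > 0 → n ≢ 2
  n≢2 k>0 n≡2 = <-irrefl (trans (sym n≡2) n≡4k+2) (+-monoˡ-< 2 (*-monoʳ-< 4 k>0))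

  collapse : ∀ {e z} → Triple e half z → Pair e (e ⊕ half) z
  collapse (inj₁ z≡e) = inj₁ z≡e
  collapse (inj₂ (inj₁ z≡e+half)) = inj₂ z≡e+half
  collapse {e} (inj₂ (inj₂ z≡e+2half)) =
    inj₁ (trans z≡e+2half (trans (⊕-assoc e half half) (trans (cong (e ⊕_) half⊕half≡0) (⊕-identityʳ e))))

  classify : Saturated _⊕_ U → Shape U → Families
  classify sat (odd-only all-odd) = by-size (k ≟ℕ 0)
    where
    by-size : Dec (k ≡ 0) → Families
    by-size (yes k≡0) = inj₂ (inj₁ (0ₙ , ≐-if-saturated _⊕_ sat (pair? 0ₙ (0ₙ ⊕ half))
      (avoidable-Pair (x≢x∙y 0ₙ (odd⇒≢0 half-is-odd)))
      λ z z∈U → inj₂ (trans (odd-is-half (cong (λ k → 1 + k * 2) k≡0) (all-odd z z∈U))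
                            (sym (⊕-identityˡ half)))))
    by-size (no k≢0)  = inj₂ (inj₂ (n≢0⇒n>0 k≢0 , ≐-if-saturated _⊕_ sat oddSet? avoidable-OddSet
      λ z z∈U → Equivalence.to (odd⇔oddSet z) (all-odd z z∈U)))
  classify sat (in-triple {e} {x} e-even x-odd U⊆T) = by-step (x ≟ half)
    where
    by-step : Dec (x ≡ half) → Families
    by-step (yes refl)  = inj₂ (inj₁ (e , ≐-if-saturated _⊕_ sat (pair? e (e ⊕ half))
      (avoidable-Pair (x≢x∙y e (odd⇒≢0 half-is-odd))) λ z → collapse ∘ U⊆T z))
    by-step (no x≢half) = inj₁ (e , x , x-odd , x≢half , e-even ,
      ≐-if-saturated _⊕_ sat (triple? e x) (avoidable-Triple e-even x-odd) U⊆T)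
  classify sat (in-even-pair {e₁} {e₂} e₁-even e₂-even e₁≢e₂ U⊆P) =
    inj₁ (e₁ , h , h-odd , h≢half , e₁-even ,
          ≐-if-saturated _⊕_ sat (triple? e₁ h) (avoidable-Triple e₁-even h-odd) λ z → pair⊆triple h⊕h≡d ∘ U⊆P z)
    where
    root = odd-root half-is-odd (double-∙ e₂-even (double-⁻¹ e₁-even))
    h = proj₁ root
    h-odd = proj₁ (proj₂ root)
    h⊕h≡d = proj₂ (proj₂ root)
    h≢half : h ≢ half
    h≢half h≡half =
      e₁≢e₂ (sym (x∙y⁻¹≈ε⇒x≈y e₂ e₁ (trans (sym h⊕h≡d) (trans (cong (λ y → y ⊕ y) h≡half) half⊕half≡0))))

  to : Saturated _⊕_ U → Families
  to sat = classify sat (avoided-shape (proj₂ (proj₂ (avoidable⇒colouring _⊕_ (proj₁ sat)))))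

  from : Families → Saturated _⊕_ U
  from (inj₁ (a , x , x-odd , x≢half , a-even , U≐T)) =
    saturated-if-≐ _⊕_ U≐T (avoidable-Triple a-even x-odd)
      (maximal-Triple a-even x-odd (odd-step-nondegenerate x-odd x≢half))
  from (inj₂ (inj₁ (a , U≐P))) =
    saturated-if-≐ _⊕_ U≐P (avoidable-Pair (x≢x∙y a (odd⇒≢0 half-is-odd))) (maximal-half-Pair half-is-odd a)
  from (inj₂ (inj₂ (k>0 , U≐O))) = saturated-if-≐ _⊕_ U≐O avoidable-OddSet (maximal-OddSet (n≢2 k>0))

classification-4k : ∀ (n k : ℕ) {{_ : NonZero n}} → n ≡ 4 * k → (U : Subset n) →
  Saturated _⊕_ U ⇔
    ((∃₂ λ (a x : Fin n) → Odd x × Even a × U ≐ Triple a x)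
    ⊎ (∃₂ λ (a x : Fin n) → Even a × x ⊕ x ⊕ x ⊕ x ≢ [ 0 ]ₙ × U ≐ Pair a (a ⊕ (x ⊕ x ⊕ x ⊕ x)))
    ⊎ U ≐ OddSet)
classification-4k n k n≡4k U = mk⇔ to from
  where
  M = k * 2
  n≡M+M : n ≡ M + M
  n≡M+M = trans n≡4k (regroup k)
    where
    regroup : ∀ k → 4 * k ≡ k * 2 + k * 2
    regroup = solve-∀
  instance
    M≢0 : NonZero M
    M≢0 = ≢-nonZero (λ M≡0 → ≢-nonZero⁻¹ n (trans n≡M+M (cong (λ m → m + m) M≡0)))
  open ZMod n
  open Halving n≡M+M using (even-or-odd)
  open EvenModulus n≡M+M
  open import Algebra.Properties.AbelianGroup abelianGroup using (x∙y⁻¹≈ε⇒x≈y)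

  Families : Set
  Families = (∃₂ λ (a x : Fin n) → Odd x × Even a × U ≐ Triple a x)
           ⊎ (∃₂ λ (a x : Fin n) → Even a × x ⊕ x ⊕ x ⊕ x ≢ 0ₙ × U ≐ Pair a (a ⊕ (x ⊕ x ⊕ x ⊕ x)))
           ⊎ U ≐ OddSet

  half-is-even : Even half
  half-is-even = half-even {k} refl

  n≢2 : n ≢ 2
  n≢2 n≡2 = 4*k≢2 k (trans (sym n≡4k) n≡2)
    where
    4*k≢2 : ∀ k → 4 * k ≢ 2
    4*k≢2 zero ()
    4*k≢2 (suc k) 4k≡2 =
      <⇒≱ (s≤s (s≤s (s≤s z≤n))) (subst (4 ≤_) 4k≡2 (*-monoʳ-≤ 4 (s≤s (z≤n {k}))))

  classify : Saturated _⊕_ U → Shape U → Families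
  classify sat (odd-only all-odd) = inj₂ (inj₂ (≐-if-saturated _⊕_ sat oddSet? avoidable-OddSet
    λ z z∈U → Equivalence.to (odd⇔oddSet z) (all-odd z z∈U)))
  classify sat (in-triple {e} {x} e-even x-odd U⊆T) =
    inj₁ (e , x , x-odd , e-even , ≐-if-saturated _⊕_ sat (triple? e x) (avoidable-Triple e-even x-odd) U⊆T)
  classify sat (in-even-pair {e₁} {e₂} e₁-even e₂-even e₁≢e₂ U⊆P) = by-root (even-or-odd h)
    where
    root = double-∙ e₂-even (double-⁻¹ e₁-even)
    h = proj₁ root
    h⊕h≡d = proj₂ root
    by-root : Even h ⊎ Odd h → Families
    by-root (inj₂ h-odd) = inj₁ (e₁ , h , h-odd , e₁-even ,
      ≐-if-saturated _⊕_ sat (triple? e₁ h) (avoidable-Triple e₁-even h-odd) λ z → pair⊆triple h⊕h≡d ∘ U⊆P z)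
    by-root (inj₁ (w , w⊕w≡h)) = inj₂ (inj₁ (e₁ , w , e₁-even , 4w≢0 ,
      ≐-if-saturated _⊕_ sat (pair? e₁ (e₁ ⊕ 4w)) (avoidable-Pair (x≢x∙y e₁ 4w≢0))
        λ z → map id (λ z≡e₂ → trans z≡e₂ (sym e₁⊕4w≡e₂)) ∘ U⊆P z))
      where
      4w = w ⊕ w ⊕ w ⊕ w
      4w≡d : 4w ≡ e₂ - e₁
      4w≡d = trans (⊕-assoc (w ⊕ w) w w) (trans (cong₂ _⊕_ w⊕w≡h w⊕w≡h) h⊕h≡d)
      e₁⊕4w≡e₂ : e₁ ⊕ 4w ≡ e₂
      e₁⊕4w≡e₂ = trans (cong (e₁ ⊕_) 4w≡d) (x∙[y-x]≡y e₁ e₂)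
      4w≢0 : 4w ≢ 0ₙ
      4w≢0 4w≡0 = e₁≢e₂ (sym (x∙y⁻¹≈ε⇒x≈y e₂ e₁ (trans (sym 4w≡d) 4w≡0)))

  to : Saturated _⊕_ U → Families
  to sat = classify sat (avoided-shape (proj₂ (proj₂ (avoidable⇒colouring _⊕_ (proj₁ sat)))))

  from : Families → Saturated _⊕_ U
  from (inj₁ (a , x , x-odd , a-even , U≐T)) =
    saturated-if-≐ _⊕_ U≐T (avoidable-Triple a-even x-odd)
      (maximal-Triple a-even x-odd (odd-step-nondegenerate x-odd (odd≢even x-odd half-is-even)))
  from (inj₂ (inj₁ (a , x , a-even , 4x≢0 , U≐P))) =
    saturated-if-≐ _⊕_ U≐P (avoidable-Pair (x≢x∙y a 4x≢0))
      (maximal-quadruple-Pair half-is-even x a-even (x≢x∙y a 4x≢0))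
  from (inj₂ (inj₂ U≐O)) = saturated-if-≐ _⊕_ U≐O avoidable-OddSet (maximal-OddSet n≢2)

theorem2p3 : (∀ (n k : ℕ) {{_ : NonZero n}} → n ≡ 2 * k + 1 → (U : Subset n) →
    Saturated _⊕_ U ⇔ (∃₂ λ (a b : Fin n) → a ≢ b × U ≐ Pair a b))
    ×
    (∀ (n k : ℕ) {{_ : NonZero n}} → n ≡ 4 * k + 2 → (U : Subset n) →
    Saturated _⊕_ U ⇔
    ((∃₂ λ (a x : Fin n) → Odd x × x ≢ [ n / 2 ]ₙ × Even a × U ≐ Triple a x)
    ⊎ (∃ λ (a : Fin n) → U ≐ Pair a (a ⊕ [ n / 2 ]ₙ))
    ⊎ (k > 0 × U ≐ OddSet)))
    ×
    (∀ (n k : ℕ) {{_ : NonZero n}} → n ≡ 4 * k → (U : Subset n) →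
    Saturated _⊕_ U ⇔
    ((∃₂ λ (a x : Fin n) → Odd x × Even a × U ≐ Triple a x)
    ⊎ (∃₂ λ (a x : Fin n) → Even a × x ⊕ x ⊕ x ⊕ x ≢ [ 0 ]ₙ × U ≐ Pair a (a ⊕ (x ⊕ x ⊕ x ⊕ x)))
    ⊎ U ≐ OddSet))
theorem2p3 = odd-classification , classification-4k+2 , classification-4k
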